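{- Let $m\ge2$, $\pi$ a partition of $m$, $\mathrm{d}\ge0$, and $q=q_{\vec{\mathbb{A}}^{\mathrm{d}}_m[\pi]}$. Then the restriction $\check{\mathbb{r}}_q$ of the standard morsification $\check{\mathbb{b}}_q$ to the radical $\mathrm{rad}(q)$ is a pure bilinear form.
   Context: For a quiver $Q$ with vertices $\{1,\dots,m\}$, arrows $\{1,\dots,n\}$ and source/target maps $s,t$, $I(Q)$ is the $m\times n$ matrix with $i$-th column $\mathbf{e}_{s(i)}-\mathbf{e}_{t(i)}$ and $q_Q(x)=\frac12\|I(Q)x\|^2$. For a unit form $q:\mathbb{Z}^n\to\mathbb{Z}$, $G_q$ is the symmetric Gram matrix of $q(x+y)-q(x)-q(y)$, $\check G_q$ the upper triangular matrix with $q(x)=x^{\mathrm{tr}}\check G_qx$, and the standard morsification is $\check{\mathbb{b}}_q(x,y)=x^{\mathrm{tr}}\check G_qy$. $\mathrm{rad}(q)=\ker G_q$. If $K$ is an $n\times c$ matrix whose columns form a $\mathbb{Z}$-basis of $\mathrm{rad}(q)$, the restriction $\check{\mathbb{r}}_q$ has Gram matrix $W=K^{\mathrm{tr}}\check G_qK$; it is called pure if the image of $W:\mathbb{Z}^c\to\mathbb{Z}^c$ is a pure subgroup of $\mathbb{Z}^c$ (i.e. $ax\in\mathrm{Img}(W)$, $a\ne0$ implies $x\in\mathrm{Img}(W)$), a property independent of the basis. Standard quivers: for $\pi=(\pi_1\ge\dots\ge\pi_\ell>0)$ a partition of $m\ge2$, $\mathrm{d}\ge0$, $v_t=m-(\pi_1+\dots+\pi_t)$,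 the quiver $\vec{\mathbb{A}}^{\mathrm{d}}_m[\pi]$ has vertices $1,\dots,m$ and $n=m+\ell+2(\mathrm{d}-1)$ arrows ordered $i_1<\dots<i_{m-1}<j_1<\dots<j_{\ell-1}<k_1<\dots<k_{2\mathrm{d}}$ (numbered $1,\dots,n$), with $s(i_t)=t,t(i_t)=t+1$; $s(j_t)=v_{t-1},t(j_t)=v_t$ ($1\le t\le\ell-1$); and with $\alpha=i_{m-1}$ if $\ell=1$, $\alpha=j_{\ell-1}$ if $\ell>1$, $k_t$ goes from $s(\alpha)$ to $t(\alpha)$ for $t$ even and from $t(\alpha)$ to $s(\alpha)$ for $t$ odd. -}

module Defs where

open import Data.Nat as N using (ℕ; zero; suc; _∸_; _≡ᵇ_; _<ᵇ_; _≥_)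
open import Data.Integer as ℤ using (ℤ; +_; _+_; _-_; _*_)
open import Data.Integer.DivMod using (_/ℕ_)
open import Data.Fin using (Fin; toℕ) renaming (zero to fzero; suc to fsuc)
open import Data.Bool using (Bool; true; false; if_then_else_)
open import Data.List using (List; length; take)
open import Data.Nat.ListAction using (sum)
open import Data.List.Relation.Unary.All using (All)
open import Data.List.Relation.Unary.Linked using (Linked)
open import Data.Product using (Σ; _×_; ∃)
open import Relation.Binary.PropositionalEquality using (_≡_)
open import Relation.Nullary using (¬_)

Vecℤ : ℕ → Set
Vecℤ n = Fin n → ℤ

Mat : ℕ → ℕ → Set
Mat r c = Fin r → Fin c → ℤ

∑ : ∀ {n} → (Fin n → ℤ) → ℤ
∑ {zero}  f = + 0
∑ {suc n} f = f fzero + ∑ (λ i → f (fsuc i))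

_·_ : ∀ {r c} → Mat r c → Vecℤ c → Vecℤ r
(A · x) i = ∑ (λ j → A i j * x j)

_≐_ : ∀ {n} → Vecℤ n → Vecℤ n → Set
x ≐ y = ∀ i → x i ≡ y i

zeroV : ∀ {n} → Vecℤ n
zeroV _ = + 0

e : ∀ {n} → Fin n → Vecℤ n
e i j = if toℕ i ≡ᵇ toℕ j then + 1 else + 0

_⊕_ : ∀ {n} → Vecℤ n → Vecℤ n → Vecℤ n
(x ⊕ y) i = x i + y i

-- Quivers with vertices {1,…,m} (labelled by natural numbers 1..m)
-- and arrows indexed by Fin n (arrow number = toℕ a + 1).

record Quiver (m n : ℕ) : Set where
  field
    s t : Fin n → ℕ

open Quiver public

δ : ℕ → ℕ → ℤ
δ a b = if a ≡ᵇ b then + 1 else + 0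

-- incidence matrix I(Q): column a is e_{s(a)} - e_{t(a)}
-- (row index i : Fin m corresponds to vertex toℕ i + 1)
incidence : ∀ {m n} → Quiver m n → Mat m n
incidence Q i a = δ (suc (toℕ i)) (s Q a) - δ (suc (toℕ i)) (t Q a)

-- q_Q(x) = ½ ‖ I(Q) x ‖²   (‖Ix‖² is always even)
qQ : ∀ {m n} → Quiver m n → Vecℤ n → ℤ
qQ Q x = ∑ (λ i → (incidence Q · x) i * (incidence Q · x) i) /ℕ 2

G : ∀ {n} → (Vecℤ n → ℤ) → Mat n n
G q i j = q (e i ⊕ e j) - q (e i) - q (e j)

-- upper triangular matrix Ǧ with q(x) = xᵗ Ǧ x
Ǧ : ∀ {n} → (Vecℤ n → ℤ) → Mat n n
Ǧ q i j =
  if toℕ i ≡ᵇ toℕ j then q (e i)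
  else if toℕ i <ᵇ toℕ j then G q i j
  else + 0

inRad : ∀ {n} → (Vecℤ n → ℤ) → Vecℤ n → Set
inRad q x = (G q · x) ≐ zeroV

IsRadBasis : ∀ {n c} → (Vecℤ n → ℤ) → Mat n c → Set
IsRadBasis {n} {c} q K =
    (∀ (z : Vecℤ c) → inRad q (K · z))
  × (∀ (z : Vecℤ c) → (K · z) ≐ zeroV → z ≐ zeroV)
  × (∀ (x : Vecℤ n) → inRad q x → ∃ λ (z : Vecℤ c) → (K · z) ≐ x)

_ᵗ : ∀ {r c} → Mat r c → Mat c r
(A ᵗ) i j = A j i

_⊗_ : ∀ {r k c} → Mat r k → Mat k c → Mat r c
(A ⊗ B) i j = ∑ (λ l → A i l * B l j)

-- Gram matrix W = Kᵗ Ǧ_q K of the restriction ř_q of the standard morsification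
restrictionGram : ∀ {n c} → (Vecℤ n → ℤ) → Mat n c → Mat c c
restrictionGram q K = (K ᵗ) ⊗ (Ǧ q ⊗ K)

InImg : ∀ {c} → Mat c c → Vecℤ c → Set
InImg W x = ∃ λ y → (W · y) ≐ x

_•_ : ∀ {n} → ℤ → Vecℤ n → Vecℤ n
(a • x) i = a * x i

-- the image of W is a pure subgroup of ℤᶜ
IsPure : ∀ {c} → Mat c c → Set
IsPure {c} W = ∀ (a : ℤ) (x : Vecℤ c) → ¬ (a ≡ + 0) → InImg W (a • x) → InImg W x

IsPartition : ℕ → List ℕ → Set
IsPartition m π = All (N._<_ 0) π × Linked _≥_ π × sum π ≡ m

vpt : ℕ → List ℕ → ℕ → ℕ
vpt m π k = m ∸ sum (take k π)

nArrows : ℕ → List ℕ → ℕ → ℕ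
nArrows m π d = (m ∸ 1) N.+ (length π ∸ 1) N.+ 2 N.* d

even : ℕ → Bool
even zero = true
even (suc k) = if even k then false else true

-- source/target of α (α = i_{m-1} if ℓ = 1, α = j_{ℓ-1} if ℓ > 1)
sα tα : ℕ → List ℕ → ℕ
sα m π = if length π ≡ᵇ 1 then m ∸ 1 else vpt m π (length π ∸ 2)
tα m π = if length π ≡ᵇ 1 then m      else vpt m π (length π ∸ 1)

-- source and target of arrow number r (1-based), r = 1..n
stdSrc stdTgt : ℕ → List ℕ → ℕ → ℕ
stdSrc m π r =
  if r <ᵇ m then r                                            -- i_r, r ≤ m-1
  else if r <ᵇ m N.+ (length π ∸ 1) then vpt m π (r ∸ m)        -- j_{r-(m-1)}
  else (if even (r ∸ (m N.+ (length π ∸ 1)) N.+ 1) then sα m π else tα m π)  -- k_t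
stdTgt m π r =
  if r <ᵇ m then suc r
  else if r <ᵇ m N.+ (length π ∸ 1) then vpt m π (suc (r ∸ m))
  else (if even (r ∸ (m N.+ (length π ∸ 1)) N.+ 1) then tα m π else sα m π)

stdQuiver : (m : ℕ) (π : List ℕ) (d : ℕ) → Quiver m (nArrows m π d)
stdQuiver m π d = record
  { s = λ a → stdSrc m π (suc (toℕ a))
  ; t = λ a → stdTgt m π (suc (toℕ a)) }

{-# OPTIONS --safe #-}
module Submission where

-- The Gram matrix of q = q_Q is I(Q)ᵗ I(Q), so rad(q) consists of the flows on the connected quiver
-- Q, and the standard morsification B satisfies B(x, y) + B(y, x) = xᵗ G_q y; hence B(x, z) = -B(z, x)
-- for every flow z.  Suppose W y = a x with a ≠ 0, and let r = K y, a flow with B(Kᵢ, r) = a xᵢ for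
-- every column Kᵢ of K.  The arrows α, k₁, …, k₂d are parallel up to orientation, so consecutive ones
-- form 2-cycles D with B(D, r) equal to the difference of the values of r on them; writing D in the
-- basis K shows that a divides these differences.  Hence r = a r′ + z with r′ a flow supported on the
-- bundle α, k₁, …, k₂d and z a flow that is constant on it.  For such z the row zᵗ Ǧ_q is the
-- coboundary of an explicit potential (the value of z on the arrows j_u crossing each cut of the
-- path 1 → ⋯ → m), so B(z, s) = 0 for every flow s and B(Kᵢ, r) = a B(Kᵢ, r′).  Writing r′ = K y′
-- and cancelling a gives W y′ = x.

open import Defs
open import Data.List using (List; []; _∷_; length; take)
open import Data.List.Relation.Unary.All using (All; _∷_)
import Data.Nat.ListAction as List
open import Data.Nat as ℕ using (ℕ; zero; suc; z≤n; s≤s; _≤_; _<_; _≥_)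
import Data.Nat.Properties as ℕ
import Data.Nat.DivMod as ℕ
open import Data.Integer as ℤ using (ℤ; +_; -[1+_]; _+_; _*_; _-_; -_; 0ℤ; 1ℤ; -1ℤ)
import Data.Integer.Properties as ℤ
open import Data.Integer.DivMod using (_/ℕ_)
open import Data.Integer.Divisibility.Signed using (_∣_; divides; quotient)
open import Data.Fin using (Fin; toℕ; fromℕ<) renaming (zero to fzero; suc to fsuc)
open import Data.Fin.Properties using (toℕ<n; toℕ-fromℕ<)
open import Data.Product using (Σ; _,_; proj₁; proj₂; _×_)
open import Function using (_∘_)
open import Relation.Binary.PropositionalEquality
open import Relation.Nullary using (¬_; yes; no; contradiction)
open import Data.Sum using (_⊎_; inj₁; inj₂)
open import Data.Bool using (true; false; if_then_else_)
open import Relation.Binary.Definitions using (tri<; tri≈; tri>)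
open import Relation.Nullary.Decidable using (dec-true; dec-false)
open import Data.Integer.Tactic.RingSolver using (solve-∀)
open import Algebra.Properties.Ring ℤ.+-*-ring using (x[y-z]≈xy-xz; [y-z]x≈yx-zx)
open import Algebra.Properties.AbelianGroup ℤ.+-0-abelianGroup using (inverseˡ-unique)
open import Algebra.Properties.Semiring.Sum ℤ.+-*-semiring
  using (sum; sum-cong-≗; ∑-comm; *-distribˡ-sum; *-distribʳ-sum)
  renaming (∑-distrib-+ to sum-distrib-+)


≡ᵇ-refl : ∀ x → (x ℕ.≡ᵇ x) ≡ true
≡ᵇ-refl x = dec-true (x ℕ.≟ x) refl

≡ᵇ-≢ : ∀ {x y} → x ≢ y → (x ℕ.≡ᵇ y) ≡ false
≡ᵇ-≢ {x} {y} = dec-false (x ℕ.≟ y)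

<ᵇ-< : ∀ {x y} → x < y → (x ℕ.<ᵇ y) ≡ true
<ᵇ-< {x} {y} = dec-true (x ℕ.<? y)

<ᵇ-≮ : ∀ {x y} → ¬ x < y → (x ℕ.<ᵇ y) ≡ false
<ᵇ-≮ {x} {y} = dec-false (x ℕ.<? y)

δ-refl : ∀ x → δ x x ≡ 1ℤ
δ-refl x = cong (λ b → if b then 1ℤ else 0ℤ) (≡ᵇ-refl x)

δ-≢ : ∀ {x y} → x ≢ y → δ x y ≡ 0ℤ
δ-≢ x≢y = cong (λ b → if b then 1ℤ else 0ℤ) (≡ᵇ-≢ x≢y)

δ-sym : ∀ x y → δ x y ≡ δ y x
δ-sym x y with x ℕ.≟ y
... | yes refl = refl
... | no  x≢y  = trans (δ-≢ x≢y) (sym (δ-≢ (x≢y ∘ sym)))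

δ-+ : ∀ k x y → δ (k ℕ.+ x) (k ℕ.+ y) ≡ δ x y
δ-+ zero    x y = refl
δ-+ (suc k) x y = δ-+ k x y

⟦_<_⟧ : ℕ → ℕ → ℤ
⟦ x < v ⟧ = if x ℕ.<ᵇ v then 1ℤ else 0ℤ

⟦<⟧-yes : ∀ {x v} → x < v → ⟦ x < v ⟧ ≡ 1ℤ
⟦<⟧-yes x<v = cong (λ b → if b then 1ℤ else 0ℤ) (<ᵇ-< x<v)

⟦<⟧-no : ∀ {x v} → ¬ x < v → ⟦ x < v ⟧ ≡ 0ℤ
⟦<⟧-no x≮v = cong (λ b → if b then 1ℤ else 0ℤ) (<ᵇ-≮ x≮v)

⟦<suc⟧-⟦<⟧ : ∀ x u → ⟦ x < suc u ⟧ - ⟦ x < u ⟧ ≡ δ u x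
⟦<suc⟧-⟦<⟧ x u with ℕ.<-cmp x u
... | tri< x<u _ _ rewrite ⟦<⟧-yes (ℕ.m<n⇒m<1+n x<u) | ⟦<⟧-yes x<u | δ-≢ (ℕ.>⇒≢ x<u) = refl
... | tri≈ _ refl _ rewrite ⟦<⟧-yes (ℕ.n<1+n x) | ⟦<⟧-no (ℕ.<-irrefl {x} refl) | δ-refl x = refl
... | tri> _ _ u<x rewrite ⟦<⟧-no (ℕ.<⇒≱ u<x ∘ ℕ.s≤s⁻¹) | ⟦<⟧-no (ℕ.<⇒≯ u<x) | δ-≢ (ℕ.<⇒≢ u<x) = refl


∑≡sum : ∀ {n} (f : Vecℤ n) → ∑ f ≡ sum f
∑≡sum {zero}  f = refl
∑≡sum {suc n} f = cong (λ s → f fzero + s) (∑≡sum (f ∘ fsuc))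

∑-cong : ∀ {n} {x y : Vecℤ n} → (∀ i → x i ≡ y i) → ∑ x ≡ ∑ y
∑-cong {x = x} {y} x≗y = trans (∑≡sum x) (trans (sum-cong-≗ x≗y) (sym (∑≡sum y)))

∑-distrib-+ : ∀ {n} (x y : Vecℤ n) → ∑ (λ i → x i + y i) ≡ ∑ x + ∑ y
∑-distrib-+ {n} x y = begin
  ∑ (λ i → x i + y i)     ≡⟨ ∑≡sum (λ i → x i + y i) ⟩
  sum (λ i → x i + y i)   ≡⟨ sum-distrib-+ {n} x y ⟩
  sum x + sum y           ≡⟨ cong₂ _+_ (∑≡sum x) (∑≡sum y) ⟨
  ∑ x + ∑ y               ∎
  where open ≡-Reasoning

*-distribʳ-∑ : ∀ {n} (x : Vecℤ n) c → ∑ x * c ≡ ∑ (λ i → x i * c)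
*-distribʳ-∑ {n} x c = begin
  ∑ x * c               ≡⟨ cong (_* c) (∑≡sum x) ⟩
  sum x * c             ≡⟨ *-distribʳ-sum {n} c x ⟩
  sum (λ i → x i * c)   ≡⟨ ∑≡sum (λ i → x i * c) ⟨
  ∑ (λ i → x i * c)     ∎
  where open ≡-Reasoning

sum-assoc : ∀ {n k} (x : Vecℤ n) (M : Fin n → Fin k → ℤ) (y : Vecℤ k) →
  sum (λ a → x a * sum (λ b → M a b * y b)) ≡ sum (λ b → sum (λ a → x a * M a b) * y b)
sum-assoc {n} {k} x M y = begin
  sum (λ a → x a * sum (λ b → M a b * y b))     ≡⟨ sum-cong-≗ (λ a → *-distribˡ-sum (x a) (λ b → M a b * y b)) ⟩
  sum (λ a → sum (λ b → x a * (M a b * y b)))   ≡⟨ ∑-comm (λ a b → x a * (M a b * y b)) ⟩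
  sum (λ b → sum (λ a → x a * (M a b * y b)))   ≡⟨ sum-cong-≗ (λ b → sum-cong-≗ (λ a → ℤ.*-assoc (x a) (M a b) (y b))) ⟨
  sum (λ b → sum (λ a → x a * M a b * y b))     ≡⟨ sum-cong-≗ (λ b → *-distribʳ-sum (y b) (λ a → x a * M a b)) ⟨
  sum (λ b → sum (λ a → x a * M a b) * y b)     ∎
  where open ≡-Reasoning

·-⊗-assoc : ∀ {r k c} (A : Mat r k) (M : Mat k c) (y : Vecℤ c) → ((A ⊗ M) · y) ≐ (A · (M · y))
·-⊗-assoc A M y i = begin
  ∑ (λ j → ∑ (λ l → A i l * M l j) * y j)       ≡⟨ ∑≡sum (λ j → ∑ (λ l → A i l * M l j) * y j) ⟩
  sum (λ j → ∑ (λ l → A i l * M l j) * y j)     ≡⟨ sum-cong-≗ (λ j → cong (_* y j) (∑≡sum (λ l → A i l * M l j))) ⟩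
  sum (λ j → sum (λ l → A i l * M l j) * y j)   ≡⟨ sum-assoc (A i) M y ⟨
  sum (λ l → A i l * sum (λ j → M l j * y j))   ≡⟨ sum-cong-≗ (λ l → cong (A i l *_) (∑≡sum (λ j → M l j * y j))) ⟨
  sum (λ l → A i l * ∑ (λ j → M l j * y j))     ≡⟨ ∑≡sum (λ l → A i l * ∑ (λ j → M l j * y j)) ⟨
  ∑ (λ l → A i l * ∑ (λ j → M l j * y j))       ∎
  where open ≡-Reasoning

∑< : ℕ → (ℕ → ℤ) → ℤ
∑< n f = sum {n} (f ∘ toℕ)

∑<-cong : ∀ n {f g : ℕ → ℤ} → (∀ a → a < n → f a ≡ g a) → ∑< n f ≡ ∑< n g
∑<-cong zero    f≗g = refl
∑<-cong (suc n) f≗g = cong₂ _+_ (f≗g 0 (s≤s z≤n)) (∑<-cong n (λ a a<n → f≗g (suc a) (s≤s a<n)))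

∑<-zero : ∀ n {f : ℕ → ℤ} → (∀ a → a < n → f a ≡ 0ℤ) → ∑< n f ≡ 0ℤ
∑<-zero zero    f≗0 = refl
∑<-zero (suc n) f≗0 = cong₂ _+_ (f≗0 0 (s≤s z≤n)) (∑<-zero n (λ a a<n → f≗0 (suc a) (s≤s a<n)))

∑<-single : ∀ n i {f : ℕ → ℤ} → i < n → (∀ a → a < n → a ≢ i → f a ≡ 0ℤ) → ∑< n f ≡ f i
∑<-single (suc n) zero    {f} _ f≗0 = begin
  f 0 + ∑< n (f ∘ suc) ≡⟨ cong (λ s → f 0 + s) (∑<-zero n (λ a a<n → f≗0 (suc a) (s≤s a<n) λ ())) ⟩
  f 0 + 0ℤ             ≡⟨ ℤ.+-identityʳ (f 0) ⟩
  f 0                  ∎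
  where open ≡-Reasoning
∑<-single (suc n) (suc i) {f} (s≤s i<n) f≗0 = begin
  f 0 + ∑< n (f ∘ suc)  ≡⟨ cong (_+ ∑< n (f ∘ suc)) (f≗0 0 (s≤s z≤n) λ ()) ⟩
  0ℤ + ∑< n (f ∘ suc)   ≡⟨ ℤ.+-identityˡ _ ⟩
  ∑< n (f ∘ suc)        ≡⟨ ∑<-single n i i<n (λ a a<n a≢i → f≗0 (suc a) (s≤s a<n) (a≢i ∘ ℕ.suc-injective)) ⟩
  f (suc i)             ∎
  where open ≡-Reasoning

∑<-distrib-+ : ∀ n (f g : ℕ → ℤ) → ∑< n (λ a → f a + g a) ≡ ∑< n f + ∑< n g
∑<-distrib-+ n f g = sum-distrib-+ {n} (f ∘ toℕ) (g ∘ toℕ)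

*-distribˡ-∑< : ∀ n c (f : ℕ → ℤ) → c * ∑< n f ≡ ∑< n (λ a → c * f a)
*-distribˡ-∑< n c f = *-distribˡ-sum {n} c (f ∘ toℕ)

*-distribʳ-∑< : ∀ n c (f : ℕ → ℤ) → ∑< n f * c ≡ ∑< n (λ a → f a * c)
*-distribʳ-∑< n c f = begin
  ∑< n f * c             ≡⟨ ℤ.*-comm (∑< n f) c ⟩
  c * ∑< n f             ≡⟨ *-distribˡ-∑< n c f ⟩
  ∑< n (λ a → c * f a)   ≡⟨ ∑<-cong n (λ a _ → ℤ.*-comm c (f a)) ⟩
  ∑< n (λ a → f a * c)   ∎
  where open ≡-Reasoning

∑<-neg : ∀ n (f : ℕ → ℤ) → ∑< n (λ a → - f a) ≡ - ∑< n f
∑<-neg zero    f = refl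
∑<-neg (suc n) f = trans (cong (λ s → - f 0 + s) (∑<-neg n (f ∘ suc))) (sym (ℤ.neg-distrib-+ (f 0) _))

∑<-distrib-- : ∀ n (f g : ℕ → ℤ) → ∑< n (λ a → f a - g a) ≡ ∑< n f - ∑< n g
∑<-distrib-- n f g = trans (∑<-distrib-+ n f (λ a → - g a)) (cong (λ s → ∑< n f + s) (∑<-neg n g))

∑<-split : ∀ p k (f : ℕ → ℤ) → ∑< (p ℕ.+ k) f ≡ ∑< p f + ∑< k (λ a → f (p ℕ.+ a))
∑<-split zero    k f = sym (ℤ.+-identityˡ _)
∑<-split (suc p) k f = trans (cong (λ s → f 0 + s) (∑<-split p k (f ∘ suc))) (sym (ℤ.+-assoc (f 0) _ _))

∑<-const : ∀ k c → ∑< k (λ _ → c) ≡ + k * c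
∑<-const zero    c = sym (ℤ.*-zeroˡ c)
∑<-const (suc k) c = begin
  c + ∑< k (λ _ → c)   ≡⟨ cong (λ s → c + s) (∑<-const k c) ⟩
  c + + k * c          ≡⟨ cong (_+ + k * c) (ℤ.*-identityˡ c) ⟨
  1ℤ * c + + k * c     ≡⟨ ℤ.*-distribʳ-+ c 1ℤ (+ k) ⟨
  + suc k * c          ∎
  where open ≡-Reasoning

∑<-δ : ∀ n {x} (f : ℕ → ℤ) → x < n → ∑< n (λ a → δ a x * f a) ≡ f x
∑<-δ n {x} f x<n = begin
  ∑< n (λ a → δ a x * f a) ≡⟨ ∑<-single n x x<n (λ a _ a≢x → trans (cong (_* f a) (δ-≢ a≢x)) (ℤ.*-zeroˡ (f a))) ⟩
  δ x x * f x              ≡⟨ cong (_* f x) (δ-refl x) ⟩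
  1ℤ * f x                 ≡⟨ ℤ.*-identityˡ (f x) ⟩
  f x                      ∎
  where open ≡-Reasoning

∑<-*δ : ∀ n {x} (f : ℕ → ℤ) → x < n → ∑< n (λ a → f a * δ x a) ≡ f x
∑<-*δ n {x} f x<n = trans (∑<-cong n (λ a _ → trans (ℤ.*-comm (f a) (δ x a)) (cong (_* f a) (δ-sym x a)))) (∑<-δ n f x<n)

∑<-*-δ-pred : ∀ k (f : ℕ → ℤ) → ∑< (suc k) (λ a → f a * - δ a k) ≡ - f k
∑<-*-δ-pred k f = begin
  ∑< (suc k) (λ a → f a * - δ a k)     ≡⟨ ∑<-cong (suc k) (λ a _ → swap (f a) (δ a k)) ⟩
  ∑< (suc k) (λ a → - (δ a k * f a))   ≡⟨ ∑<-neg (suc k) (λ a → δ a k * f a) ⟩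
  - ∑< (suc k) (λ a → δ a k * f a)     ≡⟨ cong -_ (∑<-δ (suc k) f (ℕ.n<1+n k)) ⟩
  - f k                                ∎
  where
    open ≡-Reasoning
    swap : ∀ x y → x * - y ≡ - (y * x)
    swap = solve-∀

∑<-matrix-assoc : ∀ n k (x : ℕ → ℤ) (M : ℕ → ℕ → ℤ) (y : ℕ → ℤ) →
  ∑< n (λ a → x a * ∑< k (λ b → M a b * y b)) ≡ ∑< k (λ b → ∑< n (λ a → x a * M a b) * y b)
∑<-matrix-assoc n k x M y = sum-assoc {n} {k} (x ∘ toℕ) (λ i j → M (toℕ i) (toℕ j)) (y ∘ toℕ)

∑<-by-parts′ : ∀ k (g h : ℕ → ℤ) → ∑< (suc k) (λ a → h a * (g (suc a) - g a))
  ≡ ∑< k (λ a → g (suc a) * (h a - h (suc a))) + h k * g (suc k) - h 0 * g 0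
∑<-by-parts′ zero    g h = base (h 0) (g 0) (g 1)
  where
    base : ∀ h₀ g₀ g₁ → h₀ * (g₁ - g₀) + 0ℤ ≡ 0ℤ + h₀ * g₁ - h₀ * g₀
    base = solve-∀
∑<-by-parts′ (suc k) g h =
  trans (cong (λ s → h 0 * (g 1 - g 0) + s) (∑<-by-parts′ k (g ∘ suc) (h ∘ suc)))
        (step (h 0) (h 1) (g 0) (g 1) (∑< k (λ a → g (suc (suc a)) * (h (suc a) - h (suc (suc a)))))
              (h (suc k) * g (suc (suc k))))
  where
    step : ∀ h₀ h₁ g₀ g₁ S H → h₀ * (g₁ - g₀) + (S + H - h₁ * g₁) ≡ g₁ * (h₀ - h₁) + S + H - h₀ * g₀
    step = solve-∀

∑<-by-parts : ∀ k (g h : ℕ → ℤ) → g 0 ≡ 0ℤ → g (suc k) ≡ 0ℤ →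
  ∑< k (λ a → g (suc a) * (h a - h (suc a))) ≡ ∑< (suc k) (λ a → h a * (g (suc a) - g a))
∑<-by-parts k g h g₀≡0 gₖ≡0 = sym (begin
  ∑< (suc k) (λ a → h a * (g (suc a) - g a))          ≡⟨ ∑<-by-parts′ k g h ⟩
  S + h k * g (suc k) - h 0 * g 0                     ≡⟨ cong₂ (λ x y → S + h k * x - h 0 * y) gₖ≡0 g₀≡0 ⟩
  S + h k * 0ℤ - h 0 * 0ℤ                             ≡⟨ drop (h k) (h 0) S ⟩
  S                                                   ∎)
  where
    open ≡-Reasoning
    S = ∑< k (λ a → g (suc a) * (h a - h (suc a)))
    drop : ∀ x y S → S + x * 0ℤ - y * 0ℤ ≡ S
    drop = solve-∀

extend : ∀ {n} → Vecℤ n → ℕ → ℤ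
extend {zero}  x a       = 0ℤ
extend {suc n} x zero    = x fzero
extend {suc n} x (suc a) = extend (x ∘ fsuc) a

extend-toℕ : ∀ {n} (x : Vecℤ n) i → extend x (toℕ i) ≡ x i
extend-toℕ x fzero    = refl
extend-toℕ x (fsuc i) = extend-toℕ (x ∘ fsuc) i

extend-∘toℕ : ∀ {n} (f : ℕ → ℤ) a → a < n → extend {n} (f ∘ toℕ) a ≡ f a
extend-∘toℕ {suc n} f zero    _         = refl
extend-∘toℕ {suc n} f (suc a) (s≤s a<n) = extend-∘toℕ (f ∘ suc) a a<n

extend-cong : ∀ {n} {x y : Vecℤ n} → x ≐ y → ∀ a → extend x a ≡ extend y a
extend-cong {zero}  x≐y a       = refl
extend-cong {suc n} x≐y zero    = x≐y fzero
extend-cong {suc n} x≐y (suc a) = extend-cong (x≐y ∘ fsuc) a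

∑-*-e : ∀ {n} (x : Vecℤ n) (i : Fin n) → ∑ (λ j → x j * e i j) ≡ x i
∑-*-e {n} x i = begin
  ∑ (λ j → x j * e i j)                   ≡⟨ ∑≡sum (λ j → x j * e i j) ⟩
  sum {n} (λ j → x j * e i j)             ≡⟨ sum-cong-≗ (λ j → trans (ℤ.*-comm (x j) (e i j))
                                                 (cong₂ _*_ (δ-sym (toℕ i) (toℕ j)) (sym (extend-toℕ x j)))) ⟩
  ∑< n (λ a → δ a (toℕ i) * extend x a)   ≡⟨ ∑<-δ n (extend x) (toℕ<n i) ⟩
  extend x (toℕ i)                        ≡⟨ extend-toℕ x i ⟩
  x i                                     ∎
  where open ≡-Reasoning


form : ℕ → (ℕ → ℕ → ℤ) → (ℕ → ℤ) → (ℕ → ℤ) → ℤ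
form n M x y = ∑< n (λ a → x a * ∑< n (λ b → M a b * y b))

form-rows : ∀ n M x y → form n M x y ≡ ∑< n (λ b → ∑< n (λ a → x a * M a b) * y b)
form-rows n M x y = ∑<-matrix-assoc n n x M y

form-transpose : ∀ n M x y → form n M y x ≡ form n (λ a b → M b a) x y
form-transpose n M x y = trans (form-rows n M y x) (∑<-cong n (λ b _ →
  trans (ℤ.*-comm _ (x b)) (cong (x b *_) (∑<-cong n (λ a _ → ℤ.*-comm (y a) (M a b))))))

form-+ : ∀ n M N x y → form n M x y + form n N x y ≡ form n (λ a b → M a b + N a b) x y
form-+ n M N x y = begin
  form n M x y + form n N x y
    ≡⟨ ∑<-distrib-+ n (λ a → x a * ∑< n (λ b → M a b * y b)) (λ a → x a * ∑< n (λ b → N a b * y b)) ⟨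
  ∑< n (λ a → x a * ∑< n (λ b → M a b * y b) + x a * ∑< n (λ b → N a b * y b))
    ≡⟨ ∑<-cong n (λ a _ → ℤ.*-distribˡ-+ (x a) (∑< n (λ b → M a b * y b)) (∑< n (λ b → N a b * y b))) ⟨
  ∑< n (λ a → x a * (∑< n (λ b → M a b * y b) + ∑< n (λ b → N a b * y b)))
    ≡⟨ ∑<-cong n (λ a _ → cong (x a *_) (∑<-distrib-+ n (λ b → M a b * y b) (λ b → N a b * y b))) ⟨
  ∑< n (λ a → x a * ∑< n (λ b → M a b * y b + N a b * y b))
    ≡⟨ ∑<-cong n (λ a _ → cong (x a *_) (∑<-cong n (λ b _ → ℤ.*-distribʳ-+ (y b) (M a b) (N a b)))) ⟨
  form n (λ a b → M a b + N a b) x y ∎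
  where open ≡-Reasoning

form-cong : ∀ n {M N x x′ y y′} → (∀ a b → a < n → b < n → M a b ≡ N a b) →
  (∀ a → a < n → x a ≡ x′ a) → (∀ b → b < n → y b ≡ y′ b) → form n M x y ≡ form n N x′ y′
form-cong n M≗N x≗x′ y≗y′ = ∑<-cong n (λ a a<n →
  cong₂ _*_ (x≗x′ a a<n) (∑<-cong n (λ b b<n → cong₂ _*_ (M≗N a b a<n b<n) (y≗y′ b b<n))))

form-linearʳ : ∀ n M x c u v → form n M x (λ b → c * u b + v b) ≡ c * form n M x u + form n M x v
form-linearʳ n M x c u v = begin
  form n M x (λ b → c * u b + v b)                ≡⟨ form-rows n M x (λ b → c * u b + v b) ⟩
  ∑< n (λ b → R b * (c * u b + v b))              ≡⟨ ∑<-cong n (λ b _ → distribute (R b) c (u b) (v b)) ⟩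
  ∑< n (λ b → c * (R b * u b) + R b * v b)        ≡⟨ ∑<-distrib-+ n (λ b → c * (R b * u b)) (λ b → R b * v b) ⟩
  ∑< n (λ b → c * (R b * u b)) + ∑< n (λ b → R b * v b)
                                                  ≡⟨ cong (_+ ∑< n (λ b → R b * v b)) (*-distribˡ-∑< n c (λ b → R b * u b)) ⟨
  c * ∑< n (λ b → R b * u b) + ∑< n (λ b → R b * v b)
                                                  ≡⟨ cong₂ (λ p q → c * p + q) (form-rows n M x u) (form-rows n M x v) ⟨
  c * form n M x u + form n M x v                 ∎
  where
    open ≡-Reasoning
    R : ℕ → ℤ
    R b = ∑< n (λ a → x a * M a b)
    distribute : ∀ r c u v → r * (c * u + v) ≡ c * (r * u) + r * v
    distribute = solve-∀


-- The quadratic form of a quiver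

m+m≡m*2 : ∀ k → k ℕ.+ k ≡ k ℕ.* 2
m+m≡m*2 k = trans (cong (k ℕ.+_) (sym (ℕ.+-identityʳ k))) (ℕ.*-comm 2 k)

2+m+m≡[1+m]*2 : ∀ k → suc (suc (k ℕ.+ k)) ≡ suc k ℕ.* 2
2+m+m≡[1+m]*2 k = trans (cong suc (sym (ℕ.+-suc k k))) (m+m≡m*2 (suc k))

[i+i]/ℕ2≡i : ∀ i → (i + i) /ℕ 2 ≡ i
[i+i]/ℕ2≡i (+ k) = cong +_ (trans (cong (ℕ._/ 2) (m+m≡m*2 k)) (ℕ.m*n/n≡m k 2))
[i+i]/ℕ2≡i -[1+ k ] with suc (suc (k ℕ.+ k)) ℕ.% 2 in eq
... | zero  = cong (λ w → - (+ w)) (trans (cong (ℕ._/ 2) (2+m+m≡[1+m]*2 k)) (ℕ.m*n/n≡m (suc k) 2))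
... | suc _ with () ← trans (sym eq) (trans (cong (ℕ._% 2) (2+m+m≡[1+m]*2 k)) (ℕ.m*n%n≡0 (suc k) 2))

record IsArrow (m s t : ℕ) : Set where
  field
    1≤s : 1 ≤ s
    s≤m : s ≤ m
    1≤t : 1 ≤ t
    t≤m : t ≤ m
    s≢t : s ≢ t

open IsArrow

IsArrow-swap : ∀ {m s t} → IsArrow m s t → IsArrow m t s
IsArrow-swap arr = record { 1≤s = 1≤t arr ; s≤m = t≤m arr ; 1≤t = 1≤s arr ; t≤m = s≤m arr ; s≢t = s≢t arr ∘ sym }

∑-vertices : ∀ m (h : ℕ → ℤ) {w} → 1 ≤ w → w ≤ m → ∑< m (λ v → δ (suc v) w * h (suc v)) ≡ h w
∑-vertices m h {suc w} _ w<m = ∑<-δ m (h ∘ suc) w<m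

-- Arrows are indexed by ℕ (only a < n is meaningful) so that arithmetic on arrow indices is available.
module QuiverForm (m n : ℕ) (src tgt : ℕ → ℕ) (arrow : ∀ a → a < n → IsArrow m (src a) (tgt a)) where

  quiver : Quiver m n
  quiver = record { s = src ∘ toℕ ; t = tgt ∘ toℕ }

  q : Vecℤ n → ℤ
  q = qQ quiver

  ∂ : ℕ → ℕ → ℤ
  ∂ b v = δ v (src b) - δ v (tgt b)

  -- the inner product of the columns a and b of I(Q)
  ⟪_,_⟫ : ℕ → ℕ → ℤ
  ⟪ a , b ⟫ = ∂ b (src a) - ∂ b (tgt a)

  ⟪⟫-sym : ∀ a b → ⟪ a , b ⟫ ≡ ⟪ b , a ⟫
  ⟪⟫-sym a b = begin
    (δ sa sb - δ sa tb) - (δ ta sb - δ ta tb)  ≡⟨ swap-middle (δ sa sb) (δ sa tb) (δ ta sb) (δ ta tb) ⟩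
    (δ sa sb - δ ta sb) - (δ sa tb - δ ta tb)  ≡⟨ cong₂ _-_ (cong₂ _-_ (δ-sym sa sb) (δ-sym ta sb))
                                                            (cong₂ _-_ (δ-sym sa tb) (δ-sym ta tb)) ⟩
    (δ sb sa - δ sb ta) - (δ tb sa - δ tb ta)  ∎
    where
      open ≡-Reasoning
      sa = src a ; ta = tgt a ; sb = src b ; tb = tgt b
      swap-middle : ∀ x y z w → x - y - (z - w) ≡ x - z - (y - w)
      swap-middle = solve-∀

  ⟪a,a⟫≡2 : ∀ a → a < n → ⟪ a , a ⟫ ≡ + 2
  ⟪a,a⟫≡2 a a<n
    rewrite δ-refl (src a) | δ-refl (tgt a) | δ-≢ (s≢t (arrow a a<n)) | δ-≢ (s≢t (arrow a a<n) ∘ sym) = refl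

  ∑-∂ : ∀ {a} (ψ : ℕ → ℤ) → a < n → ∑< m (λ v → ∂ a (suc v) * ψ (suc v)) ≡ ψ (src a) - ψ (tgt a)
  ∑-∂ {a} ψ a<n = begin
    ∑< m (λ v → (δ (suc v) (src a) - δ (suc v) (tgt a)) * ψ (suc v))
      ≡⟨ ∑<-cong m (λ v _ → [y-z]x≈yx-zx (ψ (suc v)) (δ (suc v) (src a)) (δ (suc v) (tgt a))) ⟩
    ∑< m (λ v → δ (suc v) (src a) * ψ (suc v) - δ (suc v) (tgt a) * ψ (suc v))
      ≡⟨ ∑<-distrib-- m (λ v → δ (suc v) (src a) * ψ (suc v)) (λ v → δ (suc v) (tgt a) * ψ (suc v)) ⟩
    ∑< m (λ v → δ (suc v) (src a) * ψ (suc v)) - ∑< m (λ v → δ (suc v) (tgt a) * ψ (suc v))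
      ≡⟨ cong₂ _-_ (∑-vertices m ψ (1≤s arr) (s≤m arr)) (∑-vertices m ψ (1≤t arr) (t≤m arr)) ⟩
    ψ (src a) - ψ (tgt a) ∎
    where
      open ≡-Reasoning
      arr = arrow a a<n

  ∑-∂∂ : ∀ {a} b → a < n → ∑ {m} (λ i → ∂ a (suc (toℕ i)) * ∂ b (suc (toℕ i))) ≡ ⟪ a , b ⟫
  ∑-∂∂ {a} b a<n = trans (∑≡sum {m} (λ i → ∂ a (suc (toℕ i)) * ∂ b (suc (toℕ i)))) (∑-∂ (∂ b) a<n)

  I·e : ∀ (a : Fin n) (i : Fin m) → (incidence quiver · e a) i ≡ ∂ (toℕ a) (suc (toℕ i))
  I·e a i = ∑-*-e (incidence quiver i) a

  q-e : ∀ a → q (e a) ≡ 1ℤ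
  q-e a = cong (_/ℕ 2) (begin
    ∑ (λ i → (incidence quiver · e a) i * (incidence quiver · e a) i)
      ≡⟨ ∑-cong (λ i → cong₂ _*_ (I·e a i) (I·e a i)) ⟩
    ∑ {m} (λ i → ∂ (toℕ a) (suc (toℕ i)) * ∂ (toℕ a) (suc (toℕ i)))
      ≡⟨ ∑-∂∂ (toℕ a) (toℕ<n a) ⟩
    ⟪ toℕ a , toℕ a ⟫
      ≡⟨ ⟪a,a⟫≡2 (toℕ a) (toℕ<n a) ⟩
    + 2 ∎)
    where open ≡-Reasoning

  I·[e⊕e] : ∀ (a b : Fin n) (i : Fin m) →
    (incidence quiver · (e a ⊕ e b)) i ≡ ∂ (toℕ a) (suc (toℕ i)) + ∂ (toℕ b) (suc (toℕ i))
  I·[e⊕e] a b i = begin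
    ∑ (λ j → I j * (e a j + e b j))        ≡⟨ ∑-cong (λ j → ℤ.*-distribˡ-+ (I j) (e a j) (e b j)) ⟩
    ∑ (λ j → I j * e a j + I j * e b j)    ≡⟨ ∑-distrib-+ (λ j → I j * e a j) (λ j → I j * e b j) ⟩
    ∑ (λ j → I j * e a j) + ∑ (λ j → I j * e b j)  ≡⟨ cong₂ _+_ (I·e a i) (I·e b i) ⟩
    ∂ (toℕ a) (suc (toℕ i)) + ∂ (toℕ b) (suc (toℕ i)) ∎
    where
      open ≡-Reasoning
      I = incidence quiver i

  q-e⊕e : ∀ a b → q (e a ⊕ e b) ≡ + 2 + ⟪ toℕ a , toℕ b ⟫
  q-e⊕e a b = trans (cong (_/ℕ 2) ‖I[e⊕e]‖²) ([i+i]/ℕ2≡i (+ 2 + ⟪ toℕ a , toℕ b ⟫))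
    where
      open ≡-Reasoning
      X Y : Fin m → ℤ
      X i = ∂ (toℕ a) (suc (toℕ i))
      Y i = ∂ (toℕ b) (suc (toℕ i))
      square : ∀ x y → (x + y) * (x + y) ≡ (x * x + x * y) + (y * y + y * x)
      square = solve-∀
      ‖I[e⊕e]‖² : ∑ (λ i → (incidence quiver · (e a ⊕ e b)) i * (incidence quiver · (e a ⊕ e b)) i)
                 ≡ (+ 2 + ⟪ toℕ a , toℕ b ⟫) + (+ 2 + ⟪ toℕ a , toℕ b ⟫)
      ‖I[e⊕e]‖² = begin
        ∑ (λ i → (incidence quiver · (e a ⊕ e b)) i * (incidence quiver · (e a ⊕ e b)) i)
          ≡⟨ ∑-cong (λ i → trans (cong₂ _*_ (I·[e⊕e] a b i) (I·[e⊕e] a b i)) (square (X i) (Y i))) ⟩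
        ∑ (λ i → (X i * X i + X i * Y i) + (Y i * Y i + Y i * X i))
          ≡⟨ ∑-distrib-+ (λ i → X i * X i + X i * Y i) (λ i → Y i * Y i + Y i * X i) ⟩
        ∑ (λ i → X i * X i + X i * Y i) + ∑ (λ i → Y i * Y i + Y i * X i)
          ≡⟨ cong₂ _+_ (∑-distrib-+ (λ i → X i * X i) (λ i → X i * Y i))
                       (∑-distrib-+ (λ i → Y i * Y i) (λ i → Y i * X i)) ⟩
        (∑ (λ i → X i * X i) + ∑ (λ i → X i * Y i)) + (∑ (λ i → Y i * Y i) + ∑ (λ i → Y i * X i))
          ≡⟨ cong₂ _+_ (cong₂ _+_ (∑-∂∂ (toℕ a) (toℕ<n a)) (∑-∂∂ (toℕ b) (toℕ<n a)))
                       (cong₂ _+_ (∑-∂∂ (toℕ b) (toℕ<n b)) (∑-∂∂ (toℕ a) (toℕ<n b))) ⟩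
        (⟪ toℕ a , toℕ a ⟫ + ⟪ toℕ a , toℕ b ⟫) + (⟪ toℕ b , toℕ b ⟫ + ⟪ toℕ b , toℕ a ⟫)
          ≡⟨ cong₂ _+_ (cong (_+ ⟪ toℕ a , toℕ b ⟫) (⟪a,a⟫≡2 (toℕ a) (toℕ<n a)))
                       (cong₂ _+_ (⟪a,a⟫≡2 (toℕ b) (toℕ<n b)) (⟪⟫-sym (toℕ b) (toℕ a))) ⟩
        (+ 2 + ⟪ toℕ a , toℕ b ⟫) + (+ 2 + ⟪ toℕ a , toℕ b ⟫) ∎

  G≡⟪⟫ : ∀ a b → G q a b ≡ ⟪ toℕ a , toℕ b ⟫
  G≡⟪⟫ a b = begin
    q (e a ⊕ e b) - q (e a) - q (e b)      ≡⟨ cong₂ _-_ (cong₂ _-_ (q-e⊕e a b) (q-e a)) (q-e b) ⟩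
    + 2 + ⟪ toℕ a , toℕ b ⟫ - 1ℤ - 1ℤ     ≡⟨ 2+p-1-1≡p ⟪ toℕ a , toℕ b ⟫ ⟩
    ⟪ toℕ a , toℕ b ⟫                      ∎
    where
      open ≡-Reasoning
      2+p-1-1≡p : ∀ p → + 2 + p - 1ℤ - 1ℤ ≡ p
      2+p-1-1≡p = solve-∀

  Ǧℕ : ℕ → ℕ → ℤ
  Ǧℕ a b = if a ℕ.≡ᵇ b then 1ℤ else if a ℕ.<ᵇ b then ⟪ a , b ⟫ else 0ℤ

  Ǧ≡Ǧℕ : ∀ a b → Ǧ q a b ≡ Ǧℕ (toℕ a) (toℕ b)
  Ǧ≡Ǧℕ a b = cong₂ (λ x y → if toℕ a ℕ.≡ᵇ toℕ b then x else if toℕ a ℕ.<ᵇ toℕ b then y else 0ℤ)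
    (q-e a) (G≡⟪⟫ a b)

  Ǧℕ-diag : ∀ a → Ǧℕ a a ≡ 1ℤ
  Ǧℕ-diag a rewrite ≡ᵇ-refl a = refl

  Ǧℕ-< : ∀ {a b} → a < b → Ǧℕ a b ≡ ⟪ a , b ⟫
  Ǧℕ-< a<b rewrite ≡ᵇ-≢ (ℕ.<⇒≢ a<b) | <ᵇ-< a<b = refl

  Ǧℕ-> : ∀ {a b} → b < a → Ǧℕ a b ≡ 0ℤ
  Ǧℕ-> b<a rewrite ≡ᵇ-≢ (ℕ.>⇒≢ b<a) | <ᵇ-≮ (ℕ.<⇒≯ b<a) = refl

  Ǧℕ+Ǧℕᵗ : ∀ a b → a < n → Ǧℕ a b + Ǧℕ b a ≡ ⟪ a , b ⟫
  Ǧℕ+Ǧℕᵗ a b a<n with ℕ.<-cmp a b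
  ... | tri< a<b _ _ = trans (cong₂ _+_ (Ǧℕ-< a<b) (Ǧℕ-> a<b)) (ℤ.+-identityʳ _)
  ... | tri≈ _ refl _ = trans (cong₂ _+_ (Ǧℕ-diag a) (Ǧℕ-diag a)) (sym (⟪a,a⟫≡2 a a<n))
  ... | tri> _ _ b<a = trans (cong₂ _+_ (Ǧℕ-> b<a) (Ǧℕ-< b<a)) (trans (ℤ.+-identityˡ _) (⟪⟫-sym b a))

  Gℕ : (ℕ → ℤ) → ℕ → ℤ
  Gℕ x b = ∑< n (λ a → ⟪ b , a ⟫ * x a)

  Rad : (ℕ → ℤ) → Set
  Rad x = ∀ b → b < n → Gℕ x b ≡ 0ℤ

  Gℕ-cong : ∀ {x y} → (∀ a → a < n → x a ≡ y a) → ∀ b → Gℕ x b ≡ Gℕ y b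
  Gℕ-cong x≗y b = ∑<-cong n (λ a a<n → cong (⟪ b , a ⟫ *_) (x≗y a a<n))

  G·≡Gℕ : ∀ (x : Vecℤ n) i → (G q · x) i ≡ Gℕ (extend x) (toℕ i)
  G·≡Gℕ x i = trans (∑≡sum (λ j → G q i j * x j))
    (sum-cong-≗ (λ j → cong₂ _*_ (G≡⟪⟫ i j) (sym (extend-toℕ x j))))

  inRad⇒Rad : ∀ x → inRad q x → Rad (extend x)
  inRad⇒Rad x x∈rad b b<n = begin
    Gℕ (extend x) b                 ≡⟨ cong (Gℕ (extend x)) (toℕ-fromℕ< b<n) ⟨
    Gℕ (extend x) (toℕ (fromℕ< b<n)) ≡⟨ G·≡Gℕ x (fromℕ< b<n) ⟨
    (G q · x) (fromℕ< b<n)          ≡⟨ x∈rad (fromℕ< b<n) ⟩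
    0ℤ                              ∎
    where open ≡-Reasoning

  Rad⇒inRad : ∀ x → Rad x → inRad q (x ∘ toℕ)
  Rad⇒inRad x x∈Rad i = begin
    (G q · (x ∘ toℕ)) i              ≡⟨ G·≡Gℕ (x ∘ toℕ {n}) i ⟩
    Gℕ (extend {n} (x ∘ toℕ)) (toℕ i) ≡⟨ Gℕ-cong (extend-∘toℕ {n} x) (toℕ i) ⟩
    Gℕ x (toℕ i)                     ≡⟨ x∈Rad (toℕ i) (toℕ<n i) ⟩
    0ℤ                               ∎
    where open ≡-Reasoning

  Rad-combination : ∀ {x y} c → Rad x → Rad y → Rad (λ a → x a - c * y a)
  Rad-combination {x} {y} c x∈Rad y∈Rad b b<n = begin
    ∑< n (λ a → ⟪ b , a ⟫ * (x a - c * y a))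
      ≡⟨ ∑<-cong n (λ a _ → distribute ⟪ b , a ⟫ (x a) c (y a)) ⟩
    ∑< n (λ a → ⟪ b , a ⟫ * x a - c * (⟪ b , a ⟫ * y a))
      ≡⟨ ∑<-distrib-- n (λ a → ⟪ b , a ⟫ * x a) (λ a → c * (⟪ b , a ⟫ * y a)) ⟩
    Gℕ x b - ∑< n (λ a → c * (⟪ b , a ⟫ * y a))
      ≡⟨ cong (λ w → Gℕ x b - w) (*-distribˡ-∑< n c (λ a → ⟪ b , a ⟫ * y a)) ⟨
    Gℕ x b - c * Gℕ y b
      ≡⟨ cong₂ (λ p q → p - c * q) (x∈Rad b b<n) (y∈Rad b b<n) ⟩
    0ℤ - c * 0ℤ
      ≡⟨ cong (λ w → 0ℤ - w) (ℤ.*-zeroʳ c) ⟩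
    0ℤ ∎
    where
      open ≡-Reasoning
      distribute : ∀ p u c v → p * (u - c * v) ≡ p * u - c * (p * v)
      distribute = solve-∀

  B : (ℕ → ℤ) → (ℕ → ℤ) → ℤ
  B = form n Ǧℕ

  B-congˡ : ∀ {x x′} y → (∀ a → a < n → x a ≡ x′ a) → B x y ≡ B x′ y
  B-congˡ {x} {x′} y x≗x′ = form-cong n {Ǧℕ} {Ǧℕ} {x} {x′} {y} {y} (λ _ _ _ _ → refl) x≗x′ (λ _ _ → refl)

  B-congʳ : ∀ x {y y′} → (∀ b → b < n → y b ≡ y′ b) → B x y ≡ B x y′
  B-congʳ x {y} {y′} y≗y′ = form-cong n {Ǧℕ} {Ǧℕ} {x} {x} {y} {y′} (λ _ _ _ _ → refl) (λ _ _ → refl) y≗y′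

  B-antisym : ∀ x y → Rad y → B x y ≡ - B y x
  B-antisym x y y∈Rad = inverseˡ-unique (B x y) (B y x) (begin
    B x y + B y x                               ≡⟨ cong (λ s → B x y + s) (form-transpose n Ǧℕ x y) ⟩
    form n Ǧℕ x y + form n (λ a b → Ǧℕ b a) x y ≡⟨ form-+ n Ǧℕ (λ a b → Ǧℕ b a) x y ⟩
    form n (λ a b → Ǧℕ a b + Ǧℕ b a) x y        ≡⟨ form-cong n {M = λ a b → Ǧℕ a b + Ǧℕ b a} {N = ⟪_,_⟫} {x = x} {y = y}
                                                     (λ a b a<n _ → Ǧℕ+Ǧℕᵗ a b a<n) (λ _ _ → refl) (λ _ _ → refl) ⟩
    ∑< n (λ a → x a * Gℕ y a)                   ≡⟨ ∑<-zero n (λ a a<n → trans (cong (x a *_) (y∈Rad a a<n))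
                                                                                 (ℤ.*-zeroʳ (x a))) ⟩
    0ℤ                                          ∎)
    where open ≡-Reasoning

  flux : (ℕ → ℤ) → (ℕ → ℤ) → ℤ
  flux x ψ = ∑< n (λ a → x a * (ψ (src a) - ψ (tgt a)))

  boundary : (ℕ → ℤ) → ℕ → ℤ
  boundary x v = ∑< n (λ a → x a * ∂ a v)

  flux≡∑ψ·boundary : ∀ x ψ → flux x ψ ≡ ∑< m (λ v → ψ (suc v) * boundary x (suc v))
  flux≡∑ψ·boundary x ψ = begin
    flux x ψ                                                ≡⟨ ∑<-cong n (λ a a<n → cong (x a *_) (∑-∂ ψ a<n)) ⟨
    ∑< n (λ a → x a * ∑< m (λ v → ∂ a (suc v) * ψ (suc v))) ≡⟨ ∑<-matrix-assoc n m x (λ a v → ∂ a (suc v)) (ψ ∘ suc) ⟩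
    ∑< m (λ v → boundary x (suc v) * ψ (suc v))              ≡⟨ ∑<-cong m (λ v _ → ℤ.*-comm (boundary x (suc v)) (ψ (suc v))) ⟩
    ∑< m (λ v → ψ (suc v) * boundary x (suc v))              ∎
    where open ≡-Reasoning

  Gℕ≡boundary-difference : ∀ x b → Gℕ x b ≡ boundary x (src b) - boundary x (tgt b)
  Gℕ≡boundary-difference x b = begin
    ∑< n (λ a → ⟪ b , a ⟫ * x a)                             ≡⟨ ∑<-cong n (λ a _ → ℤ.*-comm ⟪ b , a ⟫ (x a)) ⟩
    ∑< n (λ a → x a * (∂ a (src b) - ∂ a (tgt b)))           ≡⟨ ∑<-cong n (λ a _ → x[y-z]≈xy-xz (x a) (∂ a (src b)) (∂ a (tgt b))) ⟩
    ∑< n (λ a → x a * ∂ a (src b) - x a * ∂ a (tgt b))       ≡⟨ ∑<-distrib-- n (λ a → x a * ∂ a (src b)) (λ a → x a * ∂ a (tgt b)) ⟩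
    boundary x (src b) - boundary x (tgt b)                  ∎
    where open ≡-Reasoning

  ContainsPath : Set
  ContainsPath = ∀ a → suc a < m → a < n × src a ≡ suc a × tgt a ≡ suc (suc a)

  module _ (path : ContainsPath) (1≤m : 1 ≤ m) (x : ℕ → ℤ) (x∈Rad : Rad x) where

    boundary-constant : ∀ v → v < m → boundary x (suc v) ≡ boundary x 1
    boundary-constant zero    _      = refl
    boundary-constant (suc v) 1+v<m with path v 1+v<m
    ... | v<n , src≡ , tgt≡ = begin
      boundary x (suc (suc v)) ≡⟨ ℤ.i-j≡0⇒i≡j (boundary x (suc v)) (boundary x (suc (suc v))) no-jump ⟨
      boundary x (suc v)       ≡⟨ boundary-constant v (ℕ.<-trans (ℕ.n<1+n v) 1+v<m) ⟩
      boundary x 1             ∎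
      where
        open ≡-Reasoning
        no-jump : boundary x (suc v) - boundary x (suc (suc v)) ≡ 0ℤ
        no-jump = begin
          boundary x (suc v) - boundary x (suc (suc v)) ≡⟨ cong₂ (λ s t → boundary x s - boundary x t) src≡ tgt≡ ⟨
          boundary x (src v) - boundary x (tgt v)       ≡⟨ Gℕ≡boundary-difference x v ⟨
          Gℕ x v                                        ≡⟨ x∈Rad v v<n ⟩
          0ℤ                                            ∎

    boundary≡0 : ∀ v → v < m → boundary x (suc v) ≡ 0ℤ
    boundary≡0 v v<m = trans (boundary-constant v v<m)
      (ℤ.*-cancelˡ-≡ (+ m) (boundary x 1) 0ℤ {{ℤ.≢-nonZero (ℕ.<⇒≢ 1≤m ∘ sym ∘ ℤ.+-injective)}} (begin
        + m * boundary x 1                              ≡⟨ ∑<-const m (boundary x 1) ⟨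
        ∑< m (λ _ → boundary x 1)                       ≡⟨ ∑<-cong m (λ v v<m → boundary-constant v v<m) ⟨
        ∑< m (λ v → boundary x (suc v))                 ≡⟨ ∑<-cong m (λ v _ → ℤ.*-identityˡ (boundary x (suc v))) ⟨
        ∑< m (λ v → 1ℤ * boundary x (suc v))            ≡⟨ flux≡∑ψ·boundary x (λ _ → 1ℤ) ⟨
        flux x (λ _ → 1ℤ)                               ≡⟨ ∑<-zero n (λ a _ → ℤ.*-zeroʳ (x a)) ⟩
        0ℤ                                              ≡⟨ ℤ.*-zeroʳ (+ m) ⟨
        + m * 0ℤ                                        ∎))
      where open ≡-Reasoning

    Rad⇒flux≡0 : ∀ ψ → flux x ψ ≡ 0ℤ
    Rad⇒flux≡0 ψ = trans (flux≡∑ψ·boundary x ψ)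
      (∑<-zero m (λ v v<m → trans (cong (ψ (suc v) *_) (boundary≡0 v v<m)) (ℤ.*-zeroʳ (ψ (suc v)))))

  Ǧ·≡ : ∀ (w : Vecℤ n) l → (Ǧ q · w) l ≡ ∑< n (λ b → Ǧℕ (toℕ l) b * extend w b)
  Ǧ·≡ w l = trans (∑≡sum (λ l′ → Ǧ q l l′ * w l′))
    (sum-cong-≗ (λ l′ → cong₂ _*_ (Ǧ≡Ǧℕ l l′) (sym (extend-toℕ w l′))))

  column : ∀ {c} → Mat n c → Fin c → ℕ → ℤ
  column K i = extend (λ l → K l i)

  B-extend : ∀ (x : Vecℤ n) y → B (extend x) y ≡ sum (λ l → x l * ∑< n (λ b → Ǧℕ (toℕ l) b * y b))
  B-extend x y = sum-cong-≗ (λ l → cong (_* ∑< n (λ b → Ǧℕ (toℕ l) b * y b)) (extend-toℕ x l))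

  restrictionGram·≡B : ∀ {c} (K : Mat n c) y i → (restrictionGram q K · y) i ≡ B (column K i) (extend (K · y))
  restrictionGram·≡B K y i = begin
    (((K ᵗ) ⊗ (Ǧ q ⊗ K)) · y) i                  ≡⟨ ·-⊗-assoc (K ᵗ) (Ǧ q ⊗ K) y i ⟩
    ∑ (λ l → K l i * ((Ǧ q ⊗ K) · y) l)           ≡⟨ ∑-cong (λ l → cong (K l i *_) (·-⊗-assoc (Ǧ q) K y l)) ⟩
    ∑ (λ l → K l i * (Ǧ q · (K · y)) l)           ≡⟨ ∑≡sum (λ l → K l i * (Ǧ q · (K · y)) l) ⟩
    sum (λ l → K l i * (Ǧ q · (K · y)) l)         ≡⟨ sum-cong-≗ (λ l → cong (K l i *_) (Ǧ·≡ (K · y) l)) ⟩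
    sum (λ l → K l i * ∑< n (λ b → Ǧℕ (toℕ l) b * extend (K · y) b))
                                                  ≡⟨ B-extend (λ l → K l i) (extend (K · y)) ⟨
    B (column K i) (extend (K · y))               ∎
    where open ≡-Reasoning

  B-combination : ∀ {c} (K : Mat n c) z r → B (extend (K · z)) r ≡ ∑ (λ i → z i * B (column K i) r)
  B-combination K z r = begin
    B (extend (K · z)) r                          ≡⟨ B-extend (K · z) r ⟩
    sum (λ l → (K · z) l * R l)                   ≡⟨ sum-cong-≗ (λ l → cong (_* R l) (trans (∑≡sum (λ i → K l i * z i))
                                                       (sum-cong-≗ (λ i → ℤ.*-comm (K l i) (z i))))) ⟩
    sum (λ l → sum (λ i → z i * K l i) * R l)     ≡⟨ sum-assoc z (λ i l → K l i) R ⟨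
    sum (λ i → z i * sum (λ l → K l i * R l))     ≡⟨ sum-cong-≗ (λ i → cong (z i *_) (B-extend (λ l → K l i) r)) ⟨
    sum (λ i → z i * B (column K i) r)            ≡⟨ ∑≡sum (λ i → z i * B (column K i) r) ⟨
    ∑ (λ i → z i * B (column K i) r)              ∎
    where
      open ≡-Reasoning
      R : Fin n → ℤ
      R l = ∑< n (λ b → Ǧℕ (toℕ l) b * r b)

  column∈Rad : ∀ {c} (K : Mat n c) → IsRadBasis q K → ∀ i → Rad (column K i)
  column∈Rad K (K·z∈rad , _ , _) i = inRad⇒Rad (λ l → K l i)
    (λ k → trans (∑-cong (λ j → cong (G q k j *_) (sym (∑-*-e (K j) i)))) (K·z∈rad (e i) k))

  row : (ℕ → ℤ) → ℕ → ℤ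
  row x b = ∑< n (λ a → x a * Ǧℕ a b)

  B≡∑row : ∀ x y → B x y ≡ ∑< n (λ b → row x b * y b)
  B≡∑row = form-rows n Ǧℕ

  row-split : ∀ x {b} → b < n → row x b ≡ ∑< b (λ a → x a * ⟪ a , b ⟫) + x b
  row-split x {b} b<n = begin
    ∑< n f                                                  ≡⟨ cong (λ k → ∑< k f) b+[1+k]≡n ⟨
    ∑< (b ℕ.+ suc k) f                                      ≡⟨ ∑<-split b (suc k) f ⟩
    ∑< b f + (f (b ℕ.+ 0) + ∑< k (λ a → f (b ℕ.+ suc a)))  ≡⟨ cong₂ _+_ (∑<-cong b (λ a a<b → cong (x a *_) (Ǧℕ-< a<b)))
                                                                (cong₂ _+_ diagonal (∑<-zero k below)) ⟩
    ∑< b (λ a → x a * ⟪ a , b ⟫) + (x b + 0ℤ)              ≡⟨ cong (λ s → ∑< b (λ a → x a * ⟪ a , b ⟫) + s) (ℤ.+-identityʳ (x b)) ⟩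
    ∑< b (λ a → x a * ⟪ a , b ⟫) + x b                      ∎
    where
      open ≡-Reasoning
      f : ℕ → ℤ
      f a = x a * Ǧℕ a b
      k = n ℕ.∸ suc b
      b+[1+k]≡n : b ℕ.+ suc k ≡ n
      b+[1+k]≡n = trans (ℕ.+-suc b k) (ℕ.m+[n∸m]≡n b<n)
      diagonal : f (b ℕ.+ 0) ≡ x b
      diagonal = trans (cong f (ℕ.+-identityʳ b)) (trans (cong (x b *_) (Ǧℕ-diag b)) (ℤ.*-identityʳ (x b)))
      below : ∀ a → a < k → f (b ℕ.+ suc a) ≡ 0ℤ
      below a _ = trans (cong (x (b ℕ.+ suc a) *_) (Ǧℕ-> (ℕ.m<m+n b (s≤s z≤n)))) (ℤ.*-zeroʳ (x (b ℕ.+ suc a)))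

  ⟪⟫-chain : ∀ {a b sa ta sb tb} → src a ≡ sa → tgt a ≡ ta → src b ≡ sb → tgt b ≡ tb →
    sa ≢ sb → sa ≢ tb → ta ≢ tb → ⟪ a , b ⟫ ≡ - δ ta sb
  ⟪⟫-chain {ta = ta} {sb} refl refl refl refl sa≢sb sa≢tb ta≢tb
    rewrite δ-≢ sa≢sb | δ-≢ sa≢tb | δ-≢ ta≢tb = only-middle (δ ta sb)
    where
      only-middle : ∀ y → 0ℤ - 0ℤ - (y - 0ℤ) ≡ - y
      only-middle = solve-∀

  2-cycle : ℕ → ℕ → ℤ
  2-cycle x b = δ b x + δ b (suc x)

  module _ {x} (1+x<n : suc x < n) (antiparallel : ∀ b → ⟪ x , b ⟫ + ⟪ suc x , b ⟫ ≡ 0ℤ) where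

    private
      x<n : x < n
      x<n = ℕ.<-trans (ℕ.n<1+n x) 1+x<n

      ⟪x,1+x⟫≡-2 : ⟪ x , suc x ⟫ ≡ - + 2
      ⟪x,1+x⟫≡-2 = inverseˡ-unique ⟪ x , suc x ⟫ (+ 2)
        (trans (cong (λ s → ⟪ x , suc x ⟫ + s) (sym (⟪a,a⟫≡2 (suc x) 1+x<n))) (antiparallel (suc x)))

      ∑<-2-cycle : ∀ f → ∑< n (λ a → 2-cycle x a * f a) ≡ f x + f (suc x)
      ∑<-2-cycle f = begin
        ∑< n (λ a → (δ a x + δ a (suc x)) * f a)           ≡⟨ ∑<-cong n (λ a _ → ℤ.*-distribʳ-+ (f a) (δ a x) (δ a (suc x))) ⟩
        ∑< n (λ a → δ a x * f a + δ a (suc x) * f a)       ≡⟨ ∑<-distrib-+ n (λ a → δ a x * f a) (λ a → δ a (suc x) * f a) ⟩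
        ∑< n (λ a → δ a x * f a) + ∑< n (λ a → δ a (suc x) * f a)
                                                           ≡⟨ cong₂ _+_ (∑<-δ n f x<n) (∑<-δ n f 1+x<n) ⟩
        f x + f (suc x)                                    ∎
        where open ≡-Reasoning

    2-cycle∈Rad : Rad (2-cycle x)
    2-cycle∈Rad b _ = begin
      ∑< n (λ a → ⟪ b , a ⟫ * 2-cycle x a)   ≡⟨ ∑<-cong n (λ a _ → ℤ.*-comm ⟪ b , a ⟫ (2-cycle x a)) ⟩
      ∑< n (λ a → 2-cycle x a * ⟪ b , a ⟫)   ≡⟨ ∑<-2-cycle ⟪ b ,_⟫ ⟩
      ⟪ b , x ⟫ + ⟪ b , suc x ⟫              ≡⟨ cong₂ _+_ (⟪⟫-sym b x) (⟪⟫-sym b (suc x)) ⟩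
      ⟪ x , b ⟫ + ⟪ suc x , b ⟫              ≡⟨ antiparallel b ⟩
      0ℤ                                    ∎
      where open ≡-Reasoning

    row-2-cycle : ∀ b → row (2-cycle x) b ≡ δ b x - δ b (suc x)
    row-2-cycle b = trans (∑<-2-cycle (λ a → Ǧℕ a b)) (rows b)
      where
        rows : ∀ b → Ǧℕ x b + Ǧℕ (suc x) b ≡ δ b x - δ b (suc x)
        rows b with ℕ.<-cmp b x
        ... | tri< b<x _ _ rewrite Ǧℕ-> b<x | Ǧℕ-> (ℕ.m<n⇒m<1+n b<x)
                                 | δ-≢ (ℕ.<⇒≢ b<x) | δ-≢ (ℕ.<⇒≢ (ℕ.m<n⇒m<1+n b<x)) = refl
        ... | tri≈ _ refl _ rewrite Ǧℕ-diag b | Ǧℕ-> (ℕ.n<1+n b) | δ-refl b | δ-≢ (ℕ.<⇒≢ (ℕ.n<1+n b)) = refl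
        ... | tri> _ _ x<b with ℕ.m≤n⇒m<n∨m≡n x<b
        ...   | inj₂ refl rewrite Ǧℕ-< x<b | ⟪x,1+x⟫≡-2 | Ǧℕ-diag (suc x)
                              | δ-≢ (ℕ.>⇒≢ x<b) | δ-refl (suc x) = refl
        ...   | inj₁ 1+x<b rewrite Ǧℕ-< x<b | Ǧℕ-< 1+x<b | antiparallel b
                                 | δ-≢ (ℕ.>⇒≢ x<b) | δ-≢ (ℕ.>⇒≢ 1+x<b) = refl

    B-2-cycle : ∀ r → B (2-cycle x) r ≡ r x - r (suc x)
    B-2-cycle r = begin
      B (2-cycle x) r                              ≡⟨ B≡∑row (2-cycle x) r ⟩
      ∑< n (λ b → row (2-cycle x) b * r b)         ≡⟨ ∑<-cong n (λ b _ → cong (_* r b) (row-2-cycle b)) ⟩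
      ∑< n (λ b → (δ b x - δ b (suc x)) * r b)     ≡⟨ ∑<-cong n (λ b _ → [y-z]x≈yx-zx (r b) (δ b x) (δ b (suc x))) ⟩
      ∑< n (λ b → δ b x * r b - δ b (suc x) * r b) ≡⟨ ∑<-distrib-- n (λ b → δ b x * r b) (λ b → δ b (suc x) * r b) ⟩
      ∑< n (λ b → δ b x * r b) - ∑< n (λ b → δ b (suc x) * r b)
                                                   ≡⟨ cong₂ _-_ (∑<-δ n r x<n) (∑<-δ n r 1+x<n) ⟩
      r x - r (suc x)                              ∎
      where open ≡-Reasoning


-- Quivers shaped like A⃗ᵈ_m[π]

σ : ℕ → ℤ
σ t = if even t then 1ℤ else -1ℤ

σ-suc : ∀ t → σ (suc t) ≡ - σ t
σ-suc t with even t
... | true  = refl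
... | false = refl

∑<σ : ∀ t → ∑< t σ ≡ (if even t then 0ℤ else 1ℤ)
∑<σ zero    = refl
∑<σ (suc t) = begin
  1ℤ + ∑< t (σ ∘ suc)                 ≡⟨ cong (λ s → 1ℤ + s) (trans (∑<-cong t (λ a _ → σ-suc a)) (∑<-neg t σ)) ⟩
  1ℤ - ∑< t σ                         ≡⟨ cong (λ s → 1ℤ - s) (∑<σ t) ⟩
  1ℤ - (if even t then 0ℤ else 1ℤ)    ≡⟨ flip (even t) ⟩
  (if even (suc t) then 0ℤ else 1ℤ)   ∎
  where
    open ≡-Reasoning
    flip : ∀ b → 1ℤ - (if b then 0ℤ else 1ℤ) ≡ (if (if b then false else true) then 0ℤ else 1ℤ)
    flip true  = refl
    flip false = refl

even-2* : ∀ d → even (2 ℕ.* d) ≡ true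
even-2* zero    = refl
even-2* (suc d) = begin
  even (2 ℕ.* suc d)         ≡⟨ cong even (ℕ.*-suc 2 d) ⟩
  even (suc (suc (2 ℕ.* d))) ≡⟨ double-flip (even (2 ℕ.* d)) ⟩
  even (2 ℕ.* d)             ≡⟨ even-2* d ⟩
  true                       ∎
  where
    open ≡-Reasoning
    double-flip : ∀ b → (if (if b then false else true) then false else true) ≡ b
    double-flip true  = refl
    double-flip false = refl

∑<σ-even : ∀ d → ∑< (2 ℕ.* d) σ ≡ 0ℤ
∑<σ-even d = trans (∑<σ (2 ℕ.* d)) (cong (λ b → if b then 0ℤ else 1ℤ) (even-2* d))

∑<σ-odd : ∀ d → ∑< (suc (2 ℕ.* d)) σ ≡ 1ℤ
∑<σ-odd d = trans (∑<σ (suc (2 ℕ.* d))) (cong (λ b → if (if b then false else true) then 0ℤ else 1ℤ) (even-2* d))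

split-< : ∀ p {k b} → b < p ℕ.+ k → b < p ⊎ Σ ℕ λ u → u < k × b ≡ p ℕ.+ u
split-< zero    b<k = inj₂ (_ , b<k , refl)
split-< (suc p) {b = zero}  _ = inj₁ (s≤s z≤n)
split-< (suc p) {b = suc b} (s≤s b<p+k) with split-< p b<p+k
... | inj₁ b<p              = inj₁ (s≤s b<p)
... | inj₂ (u , u<k , refl) = inj₂ (u , u<k , refl)

bounded-choice : ∀ {ℓ} {P : ℕ → ℤ → Set ℓ} k →
  (∀ t → t < k → Σ ℤ (P t)) → Σ (ℕ → ℤ) λ f → ∀ t → t < k → P t (f t)
bounded-choice zero _ = (λ _ → 0ℤ) , λ _ ()
bounded-choice {P = P} (suc k) h
  with (f₀ , p₀) ← h 0 (s≤s z≤n)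
     | (f , p)   ← bounded-choice {P = P ∘ suc} k (λ t t<k → h (suc t) (s≤s t<k))
  = (λ { zero → f₀ ; (suc t) → f t }) , λ { zero _ → p₀ ; (suc t) (s≤s t<k) → p t t<k }

module Decreasing (L : ℕ) (V : ℕ → ℕ) (V-step : ∀ u → u < L → V (suc u) < V u) where

  V-< : ∀ {x y} → x < y → y ≤ L → V y < V x
  V-< {x} {suc y} (s≤s x≤y) y<L with ℕ.m≤n⇒m<n∨m≡n x≤y
  ... | inj₁ x<y  = ℕ.<-trans (V-step y y<L) (V-< x<y (ℕ.<⇒≤ y<L))
  ... | inj₂ refl = V-step x y<L

  V-≤ : ∀ {x y} → x ≤ y → y ≤ L → V y ≤ V x
  V-≤ x≤y y≤L with ℕ.m≤n⇒m<n∨m≡n x≤y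
  ... | inj₁ x<y  = ℕ.<⇒≤ (V-< x<y y≤L)
  ... | inj₂ refl = ℕ.≤-refl

  V-injective : ∀ {x y} → x ≤ L → y ≤ L → V x ≡ V y → x ≡ y
  V-injective {x} {y} x≤L y≤L Vx≡Vy with ℕ.<-cmp x y
  ... | tri< x<y _ _ = contradiction Vx≡Vy (ℕ.>⇒≢ (V-< x<y y≤L))
  ... | tri≈ _ x≡y _ = x≡y
  ... | tri> _ _ y<x = contradiction Vx≡Vy (ℕ.<⇒≢ (V-< y<x x≤L))

-- Arrows are numbered from 0: a ≤ P is i_{a+1}, P + suc u is j_{u+1}, A = P + L is α and A + t is k_t
-- (1 ≤ t ≤ 2d); the vertices are 1, …, m with m = P + 2, and V u is v_u.
module StandardShape
  (P L d : ℕ) (V : ℕ → ℕ) (sα tα : ℕ) (src tgt : ℕ → ℕ)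
  (path-arrow : ∀ a → a ≤ P → src a ≡ suc a × tgt a ≡ suc (suc a))
  (j-arrow : ∀ u → u < L → src (P ℕ.+ suc u) ≡ V u × tgt (P ℕ.+ suc u) ≡ V (suc u))
  (k-arrow : ∀ t → t ≤ 2 ℕ.* d →
    src (P ℕ.+ L ℕ.+ t) ≡ (if even t then sα else tα) × tgt (P ℕ.+ L ℕ.+ t) ≡ (if even t then tα else sα))
  (V0≡m : V 0 ≡ suc (suc P))
  (V-step : ∀ u → u < L → V (suc u) < V u)
  (1≤V : 1 ≤ V L)
  where

  m A n : ℕ
  m = suc (suc P)
  A = P ℕ.+ L
  n = suc A ℕ.+ 2 ℕ.* d

  open Decreasing L V V-step

  V-vertex : ∀ {x} → x ≤ L → 1 ≤ V x × V x ≤ m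
  V-vertex {x} x≤L = ℕ.≤-trans 1≤V (V-≤ x≤L ℕ.≤-refl) , subst (V x ≤_) V0≡m (V-≤ z≤n x≤L)

  data ArrowKind (b : ℕ) : Set where
    path-kind : b ≤ P → ArrowKind b
    j-kind    : ∀ u → u < L → b ≡ P ℕ.+ suc u → ArrowKind b
    k-kind    : ∀ t → t < 2 ℕ.* d → b ≡ A ℕ.+ suc t → ArrowKind b

  kind : ∀ {b} → b < n → ArrowKind b
  kind b<n with split-< (suc A) b<n
  ... | inj₂ (t , t<2d , refl) = k-kind t t<2d (sym (ℕ.+-suc A t))
  ... | inj₁ b<1+A with split-< (suc P) b<1+A
  ...   | inj₁ b<1+P            = path-kind (ℕ.s≤s⁻¹ b<1+P)
  ...   | inj₂ (u , u<L , refl) = j-kind u u<L (sym (ℕ.+-suc P u))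

  A<n : A < n
  A<n = s≤s (ℕ.m≤m+n A (2 ℕ.* d))

  bundle<n : ∀ {t} → t ≤ 2 ℕ.* d → A ℕ.+ t < n
  bundle<n t≤2d = s≤s (ℕ.+-monoʳ-≤ A t≤2d)

  α-src : src A ≡ sα
  α-src = trans (cong src (sym (ℕ.+-identityʳ A))) (proj₁ (k-arrow 0 z≤n))

  α-tgt : tgt A ≡ tα
  α-tgt = trans (cong tgt (sym (ℕ.+-identityʳ A))) (proj₂ (k-arrow 0 z≤n))

  path-valid : ∀ {a} → a ≤ P → IsArrow m (src a) (tgt a)
  path-valid {a} a≤P rewrite proj₁ (path-arrow a a≤P) | proj₂ (path-arrow a a≤P) = record
    { 1≤s = s≤s z≤n ; s≤m = s≤s (ℕ.m≤n⇒m≤1+n a≤P) ; 1≤t = s≤s z≤n ; t≤m = s≤s (s≤s a≤P)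
    ; s≢t = ℕ.<⇒≢ (ℕ.n<1+n (suc a)) }

  j-valid : ∀ {u} → u < L → IsArrow m (src (P ℕ.+ suc u)) (tgt (P ℕ.+ suc u))
  j-valid {u} u<L rewrite proj₁ (j-arrow u u<L) | proj₂ (j-arrow u u<L) = record
    { 1≤s = proj₁ (V-vertex (ℕ.<⇒≤ u<L)) ; s≤m = proj₂ (V-vertex (ℕ.<⇒≤ u<L))
    ; 1≤t = proj₁ (V-vertex u<L) ; t≤m = proj₂ (V-vertex u<L) ; s≢t = ℕ.>⇒≢ (V-step u u<L) }

  α-valid : IsArrow m sα tα
  α-valid = subst₂ (IsArrow m) α-src α-tgt (A-valid (kind A<n))
    where
      A-valid : ArrowKind A → IsArrow m (src A) (tgt A)
      A-valid (path-kind A≤P)   = path-valid A≤P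
      A-valid (j-kind u u<L eq) = subst (λ b → IsArrow m (src b) (tgt b)) (sym eq) (j-valid u<L)
      A-valid (k-kind t _ eq)   = contradiction eq (ℕ.<⇒≢ (ℕ.m<m+n A (s≤s z≤n)))

  arrow : ∀ b → b < n → IsArrow m (src b) (tgt b)
  arrow b b<n with kind b<n
  ... | path-kind b≤P     = path-valid b≤P
  ... | j-kind u u<L refl = j-valid u<L
  ... | k-kind t t<2d refl rewrite proj₁ (k-arrow (suc t) t<2d) | proj₂ (k-arrow (suc t) t<2d) with even (suc t)
  ...   | true  = α-valid
  ...   | false = IsArrow-swap α-valid

  open QuiverForm m n src tgt arrow

  bundle-difference : ∀ {t} → t ≤ 2 ℕ.* d → ∀ (f : ℕ → ℤ) →
    f (src (A ℕ.+ t)) - f (tgt (A ℕ.+ t)) ≡ σ t * (f sα - f tα)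
  bundle-difference {t} t≤2d f rewrite proj₁ (k-arrow t t≤2d) | proj₂ (k-arrow t t≤2d) with even t
  ... | true  = sym (ℤ.*-identityˡ (f sα - f tα))
  ... | false = reverse (f tα) (f sα)
    where
      reverse : ∀ x y → x - y ≡ -1ℤ * (y - x)
      reverse = solve-∀

  ⟪⟫-bundleˡ : ∀ {t} → t ≤ 2 ℕ.* d → ∀ b → ⟪ A ℕ.+ t , b ⟫ ≡ σ t * ⟪ A , b ⟫
  ⟪⟫-bundleˡ {t} t≤2d b = trans (bundle-difference t≤2d (∂ b))
    (cong (σ t *_) (sym (cong₂ (λ x y → ∂ b x - ∂ b y) α-src α-tgt)))

  ⟪⟫-bundleʳ : ∀ {t} → t ≤ 2 ℕ.* d → ∀ b → ⟪ b , A ℕ.+ t ⟫ ≡ σ t * ⟪ b , A ⟫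
  ⟪⟫-bundleʳ {t} t≤2d b = trans (⟪⟫-sym b (A ℕ.+ t)) (trans (⟪⟫-bundleˡ t≤2d b) (cong (σ t *_) (⟪⟫-sym A b)))

  1+A+t<n : ∀ {t} → t < 2 ℕ.* d → suc (A ℕ.+ t) < n
  1+A+t<n t<2d = subst (_< n) (ℕ.+-suc A _) (bundle<n t<2d)

  bundle-antiparallel : ∀ {t} → t < 2 ℕ.* d → ∀ b → ⟪ A ℕ.+ t , b ⟫ + ⟪ suc (A ℕ.+ t) , b ⟫ ≡ 0ℤ
  bundle-antiparallel {t} t<2d b = begin
    ⟪ A ℕ.+ t , b ⟫ + ⟪ suc (A ℕ.+ t) , b ⟫   ≡⟨ cong (λ c → ⟪ A ℕ.+ t , b ⟫ + ⟪ c , b ⟫) (ℕ.+-suc A t) ⟨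
    ⟪ A ℕ.+ t , b ⟫ + ⟪ A ℕ.+ suc t , b ⟫     ≡⟨ cong₂ _+_ (⟪⟫-bundleˡ (ℕ.<⇒≤ t<2d) b) (⟪⟫-bundleˡ t<2d b) ⟩
    σ t * ⟪ A , b ⟫ + σ (suc t) * ⟪ A , b ⟫   ≡⟨ cong (λ s → σ t * ⟪ A , b ⟫ + s * ⟪ A , b ⟫) (σ-suc t) ⟩
    σ t * ⟪ A , b ⟫ + - σ t * ⟪ A , b ⟫       ≡⟨ cancel (σ t) ⟪ A , b ⟫ ⟩
    0ℤ                                        ∎
    where
      open ≡-Reasoning
      cancel : ∀ x y → x * y + - x * y ≡ 0ℤ
      cancel = solve-∀

  path : ContainsPath
  path a (s≤s (s≤s a≤P)) =
    s≤s (ℕ.≤-trans a≤P (ℕ.≤-trans (ℕ.m≤m+n P L) (ℕ.m≤m+n A (2 ℕ.* d)))) , path-arrow a a≤P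

  ∑-arrows : ∀ f → ∑< n f ≡ ∑< (suc P) f + ∑< L (λ u → f (P ℕ.+ suc u)) + ∑< (2 ℕ.* d) (λ t → f (A ℕ.+ suc t))
  ∑-arrows f = begin
    ∑< (suc A ℕ.+ 2 ℕ.* d) f
      ≡⟨ ∑<-split (suc A) (2 ℕ.* d) f ⟩
    ∑< (suc P ℕ.+ L) f + ∑< (2 ℕ.* d) (λ t → f (suc A ℕ.+ t))
      ≡⟨ cong₂ _+_ (∑<-split (suc P) L f) (∑<-cong (2 ℕ.* d) (λ t _ → cong f (sym (ℕ.+-suc A t)))) ⟩
    ∑< (suc P) f + ∑< L (λ u → f (suc P ℕ.+ u)) + ∑< (2 ℕ.* d) (λ t → f (A ℕ.+ suc t))
      ≡⟨ cong (λ s → ∑< (suc P) f + s + ∑< (2 ℕ.* d) (λ t → f (A ℕ.+ suc t)))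
              (∑<-cong L (λ u _ → cong f (sym (ℕ.+-suc P u)))) ⟩
    ∑< (suc P) f + ∑< L (λ u → f (P ℕ.+ suc u)) + ∑< (2 ℕ.* d) (λ t → f (A ℕ.+ suc t)) ∎
    where open ≡-Reasoning

  ⟦V<V⟧ : ∀ {x y} → x ≤ L → y ≤ L → ⟦ V y < V x ⟧ ≡ ⟦ x < y ⟧
  ⟦V<V⟧ {x} {y} x≤L y≤L with x ℕ.<? y
  ... | yes x<y = trans (⟦<⟧-yes (V-< x<y y≤L)) (sym (⟦<⟧-yes x<y))
  ... | no  x≮y = trans (⟦<⟧-no (ℕ.≤⇒≯ (V-≤ (ℕ.≮⇒≥ x≮y) x≤L))) (sym (⟦<⟧-no x≮y))

  ⟦V<1+V⟧ : ∀ {x y} → x ≤ L → y ≤ L → ⟦ V y < suc (V x) ⟧ ≡ ⟦ x < suc y ⟧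
  ⟦V<1+V⟧ {x} {y} x≤L y≤L with x ℕ.≤? y
  ... | yes x≤y = trans (⟦<⟧-yes (s≤s (V-≤ x≤y y≤L))) (sym (⟦<⟧-yes (s≤s x≤y)))
  ... | no  x≰y = trans (⟦<⟧-no (ℕ.<⇒≱ (V-< (ℕ.≰⇒> x≰y) x≤L) ∘ ℕ.s≤s⁻¹)) (sym (⟦<⟧-no (x≰y ∘ ℕ.s≤s⁻¹)))

  χ : ℕ → ℕ → ℤ
  χ u v = ⟦ V (suc u) < v ⟧ - ⟦ V u < v ⟧

  χ-V : ∀ {u x} → u < L → x ≤ L → χ u (V x) ≡ δ u x
  χ-V {u} {x} u<L x≤L = trans (cong₂ _-_ (⟦V<V⟧ x≤L u<L) (⟦V<V⟧ x≤L (ℕ.<⇒≤ u<L))) (⟦<suc⟧-⟦<⟧ x u)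

  χ-1+V : ∀ {u x} → u < L → x ≤ L → χ u (suc (V x)) ≡ δ (suc u) x
  χ-1+V {u} {x} u<L x≤L = trans (cong₂ _-_ (⟦V<1+V⟧ x≤L u<L) (⟦V<1+V⟧ x≤L (ℕ.<⇒≤ u<L))) (⟦<suc⟧-⟦<⟧ x (suc u))

  module _ (z : ℕ → ℤ) where

    -- the total value of z on the arrows j_u that cross the cut between the vertices v - 1 and v
    ψ : ℕ → ℤ
    ψ v = ∑< L (λ u → χ u v * z (P ℕ.+ suc u))

    ψ-V : ∀ {x} → x ≤ L → ψ (V x) ≡ ∑< L (λ u → δ u x * z (P ℕ.+ suc u))
    ψ-V x≤L = ∑<-cong L (λ u u<L → cong (_* z (P ℕ.+ suc u)) (χ-V u<L x≤L))

    ψ-1+V : ∀ {x} → x ≤ L → ψ (suc (V x)) ≡ ∑< L (λ u → δ (suc u) x * z (P ℕ.+ suc u))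
    ψ-1+V x≤L = ∑<-cong L (λ u u<L → cong (_* z (P ℕ.+ suc u)) (χ-1+V u<L x≤L))

    ψ-1 : ψ 1 ≡ 0ℤ
    ψ-1 = ∑<-zero L (λ u u<L → trans (cong (_* z (P ℕ.+ suc u))
      (cong₂ _-_ (⟦<⟧-no (ℕ.≤⇒≯ (proj₁ (V-vertex u<L)))) (⟦<⟧-no (ℕ.≤⇒≯ (proj₁ (V-vertex (ℕ.<⇒≤ u<L)))))))
      (ℤ.*-zeroˡ (z (P ℕ.+ suc u))))

    ψ-1+m : ψ (suc m) ≡ 0ℤ
    ψ-1+m = begin
      ψ (suc m)        ≡⟨ cong (ψ ∘ suc) V0≡m ⟨
      ψ (suc (V 0))    ≡⟨ ψ-1+V z≤n ⟩
      ∑< L (λ u → 0ℤ * z (P ℕ.+ suc u)) ≡⟨ ∑<-zero L (λ u _ → ℤ.*-zeroˡ (z (P ℕ.+ suc u))) ⟩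
      0ℤ               ∎
      where open ≡-Reasoning

    Δψ : ℕ → ℤ
    Δψ v = ψ (suc v) - ψ v

  ⟪⟫-path : ∀ {a b} → a < b → b ≤ P → ⟪ a , b ⟫ ≡ - δ (suc a) b
  ⟪⟫-path {a} {b} a<b b≤P = ⟪⟫-chain
    (proj₁ (path-arrow a (ℕ.≤-trans (ℕ.<⇒≤ a<b) b≤P))) (proj₂ (path-arrow a (ℕ.≤-trans (ℕ.<⇒≤ a<b) b≤P)))
    (proj₁ (path-arrow b b≤P)) (proj₂ (path-arrow b b≤P))
    (ℕ.<⇒≢ a<b ∘ ℕ.suc-injective) (ℕ.<⇒≢ (ℕ.m<n⇒m<1+n a<b) ∘ ℕ.suc-injective)
    (ℕ.<⇒≢ a<b ∘ ℕ.suc-injective ∘ ℕ.suc-injective)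

  δ-V : ∀ {x y} → x ≤ L → y ≤ L → δ (V x) (V y) ≡ δ x y
  δ-V {x} {y} x≤L y≤L with x ℕ.≟ y
  ... | yes refl = trans (δ-refl (V x)) (sym (δ-refl x))
  ... | no  x≢y  = trans (δ-≢ (x≢y ∘ V-injective x≤L y≤L)) (sym (δ-≢ x≢y))

  ⟪⟫-j : ∀ {u′ u} → u′ < u → u < L → ⟪ P ℕ.+ suc u′ , P ℕ.+ suc u ⟫ ≡ - δ (suc u′) u
  ⟪⟫-j {u′} {u} u′<u u<L = trans (⟪⟫-chain
    (proj₁ (j-arrow u′ u′<L)) (proj₂ (j-arrow u′ u′<L)) (proj₁ (j-arrow u u<L)) (proj₂ (j-arrow u u<L))
    (ℕ.<⇒≢ u′<u ∘ V-injective u′≤L (ℕ.<⇒≤ u<L)) (ℕ.<⇒≢ (ℕ.m<n⇒m<1+n u′<u) ∘ V-injective u′≤L u<L)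
    (ℕ.<⇒≢ u′<u ∘ ℕ.suc-injective ∘ V-injective u′<L u<L))
    (cong -_ (δ-V u′<L (ℕ.<⇒≤ u<L)))
    where
      u′<L = ℕ.<-trans u′<u u<L
      u′≤L = ℕ.<⇒≤ u′<L

  path<n : ∀ {a} → a ≤ P → a < n
  path<n a≤P = proj₁ (path _ (s≤s (s≤s a≤P)))

  OnBundle : (ℕ → ℤ) → ℤ → Set
  OnBundle z κ = ∀ t → t ≤ 2 ℕ.* d → z (A ℕ.+ t) ≡ κ

  module _ {z κ} (z∈Rad : Rad z) (z-on-bundle : OnBundle z κ) where

    -- The flux of z across the cut between a + 1 and a + 2 vanishes; the arrows crossing it are the
    -- path arrow a, some j_u (giving ψ) and the k_t (cancelling in pairs).
    z-on-path : ∀ {a} → a ≤ P → z a ≡ ψ z (suc (suc a))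
    z-on-path {a} a≤P = ℤ.i-j≡0⇒i≡j (z a) (ψ z (suc (suc a))) (begin
      z a - ψ z (suc (suc a))                            ≡⟨ ℤ.+-identityʳ _ ⟨
      z a - ψ z (suc (suc a)) + 0ℤ                       ≡⟨ cong₂ _+_ (cong₂ _+_ path-part j-part) k-part ⟨
      ∑< (suc P) f + ∑< L (λ u → f (P ℕ.+ suc u)) + ∑< (2 ℕ.* d) (λ t → f (A ℕ.+ suc t))
                                                         ≡⟨ ∑-arrows f ⟨
      flux z cut                                         ≡⟨ Rad⇒flux≡0 path (s≤s z≤n) z z∈Rad cut ⟩
      0ℤ                                                 ∎)
      where
        open ≡-Reasoning
        cut : ℕ → ℤ
        cut v = ⟦ v < suc (suc a) ⟧
        f : ℕ → ℤ
        f b = z b * (cut (src b) - cut (tgt b))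
        path-part : ∑< (suc P) f ≡ z a
        path-part = trans (∑<-cong (suc P) (λ b b<1+P → begin
            z b * (cut (src b) - cut (tgt b))
              ≡⟨ cong₂ (λ x y → z b * (cut x - cut y)) (proj₁ (path-arrow b (ℕ.s≤s⁻¹ b<1+P)))
                                                       (proj₂ (path-arrow b (ℕ.s≤s⁻¹ b<1+P))) ⟩
            z b * (⟦ b < suc a ⟧ - ⟦ b < a ⟧)    ≡⟨ cong (z b *_) (⟦<suc⟧-⟦<⟧ b a) ⟩
            z b * δ a b                          ≡⟨ trans (ℤ.*-comm (z b) (δ a b)) (cong (_* z b) (δ-sym a b)) ⟩
            δ b a * z b                          ∎))
          (∑<-δ (suc P) z (s≤s a≤P))
        j-part : ∑< L (λ u → f (P ℕ.+ suc u)) ≡ - ψ z (suc (suc a))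
        j-part = trans (∑<-cong L (λ u u<L → trans
            (cong₂ (λ x y → z (P ℕ.+ suc u) * (cut x - cut y)) (proj₁ (j-arrow u u<L)) (proj₂ (j-arrow u u<L)))
            (reverse (z (P ℕ.+ suc u)) (cut (V u)) (cut (V (suc u))))))
          (∑<-neg L (λ u → χ u (suc (suc a)) * z (P ℕ.+ suc u)))
          where
            reverse : ∀ w x y → w * (x - y) ≡ - ((y - x) * w)
            reverse = solve-∀
        k-part : ∑< (2 ℕ.* d) (λ t → f (A ℕ.+ suc t)) ≡ 0ℤ
        k-part = begin
          ∑< (2 ℕ.* d) (λ t → f (A ℕ.+ suc t))
            ≡⟨ ∑<-cong (2 ℕ.* d) (λ t t<2d → trans (cong₂ _*_ (z-on-bundle (suc t) t<2d) (bundle-difference t<2d cut))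
                                                  (rearrange κ (σ (suc t)) (cut sα - cut tα))) ⟩
          ∑< (2 ℕ.* d) (λ t → σ (suc t) * (κ * (cut sα - cut tα)))
            ≡⟨ *-distribʳ-∑< (2 ℕ.* d) (κ * (cut sα - cut tα)) (σ ∘ suc) ⟨
          ∑< (2 ℕ.* d) (σ ∘ suc) * (κ * (cut sα - cut tα))
            ≡⟨ cong (_* (κ * (cut sα - cut tα))) ∑<σ∘suc≡0 ⟩
          0ℤ * (κ * (cut sα - cut tα))
            ≡⟨ ℤ.*-zeroˡ (κ * (cut sα - cut tα)) ⟩
          0ℤ ∎
          where
            rearrange : ∀ k s y → k * (s * y) ≡ s * (k * y)
            rearrange = solve-∀
            ∑<σ∘suc≡0 : ∑< (2 ℕ.* d) (σ ∘ suc) ≡ 0ℤ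
            ∑<σ∘suc≡0 = trans (∑<-cong (2 ℕ.* d) (λ t _ → σ-suc t))
              (trans (∑<-neg (2 ℕ.* d) σ) (cong -_ (∑<σ-even d)))

    ∑-over-path : ∀ {b} → b < n → ∑< (suc P) (λ a → z a * ⟪ a , b ⟫) ≡ Δψ z (src b) - Δψ z (tgt b)
    ∑-over-path {b} b<n = begin
      ∑< (suc P) (λ a → z a * ⟪ a , b ⟫)
        ≡⟨ ∑<-cong (suc P) (λ a a<1+P → cong₂ _*_ (z-on-path (ℕ.s≤s⁻¹ a<1+P))
             (cong₂ (λ x y → ∂ b x - ∂ b y) (proj₁ (path-arrow a (ℕ.s≤s⁻¹ a<1+P))) (proj₂ (path-arrow a (ℕ.s≤s⁻¹ a<1+P))))) ⟩
      ∑< (suc P) (λ a → ψ z (suc (suc a)) * (∂ b (suc a) - ∂ b (suc (suc a))))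
        ≡⟨ ∑<-by-parts (suc P) (ψ z ∘ suc) (∂ b ∘ suc) (ψ-1 z) (ψ-1+m z) ⟩
      ∑< m (λ v → ∂ b (suc v) * Δψ z (suc v))
        ≡⟨ ∑-∂ (Δψ z) b<n ⟩
      Δψ z (src b) - Δψ z (tgt b) ∎
      where open ≡-Reasoning

    row-path : ∀ {b} → b ≤ P → row z b ≡ ψ z (tgt b) - ψ z (src b)
    row-path {zero} 0≤P = begin
      row z 0                        ≡⟨ row-split z (path<n 0≤P) ⟩
      0ℤ + z 0                       ≡⟨ ℤ.+-identityˡ (z 0) ⟩
      z 0                            ≡⟨ z-on-path 0≤P ⟩
      ψ z 2                          ≡⟨ ℤ.+-identityʳ (ψ z 2) ⟨
      ψ z 2 - 0ℤ                     ≡⟨ cong (λ w → ψ z 2 - w) (ψ-1 z) ⟨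
      ψ z 2 - ψ z 1                  ≡⟨ cong₂ (λ x y → ψ z y - ψ z x) (proj₁ (path-arrow 0 0≤P)) (proj₂ (path-arrow 0 0≤P)) ⟨
      ψ z (tgt 0) - ψ z (src 0)      ∎
      where open ≡-Reasoning
    row-path {suc b} 1+b≤P = begin
      row z (suc b)
        ≡⟨ row-split z (path<n 1+b≤P) ⟩
      ∑< (suc b) (λ a → z a * ⟪ a , suc b ⟫) + z (suc b)
        ≡⟨ cong (_+ z (suc b)) (trans (∑<-cong (suc b) (λ a a<1+b → cong (z a *_) (⟪⟫-path a<1+b 1+b≤P)))
                                      (∑<-*-δ-pred b z)) ⟩
      - z b + z (suc b)
        ≡⟨ cong₂ (λ x y → - x + y) (z-on-path (ℕ.<⇒≤ 1+b≤P)) (z-on-path 1+b≤P) ⟩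
      - ψ z (suc (suc b)) + ψ z (suc (suc (suc b)))
        ≡⟨ ℤ.+-comm (- ψ z (suc (suc b))) (ψ z (suc (suc (suc b)))) ⟩
      ψ z (suc (suc (suc b))) - ψ z (suc (suc b))
        ≡⟨ cong₂ (λ x y → ψ z y - ψ z x) (proj₁ (path-arrow (suc b) 1+b≤P)) (proj₂ (path-arrow (suc b) 1+b≤P)) ⟨
      ψ z (tgt (suc b)) - ψ z (src (suc b)) ∎
      where open ≡-Reasoning

    row-j : ∀ {u} → u < L → row z (P ℕ.+ suc u) ≡ ψ z (tgt (P ℕ.+ suc u)) - ψ z (src (P ℕ.+ suc u))
    row-j {u} u<L = begin
      row z b
        ≡⟨ row-split z b<n ⟩
      ∑< b g + z b
        ≡⟨ cong (λ k → ∑< k g + z b) (ℕ.+-suc P u) ⟩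
      ∑< (suc P ℕ.+ u) g + z b
        ≡⟨ cong (_+ z b) (∑<-split (suc P) u g) ⟩
      ∑< (suc P) g + ∑< u (λ u′ → g (suc P ℕ.+ u′)) + z b
        ≡⟨ cong₂ _+_ (cong₂ _+_ (∑-over-path b<n) (trans (∑<-cong u (λ u′ u′<u → earlier-j u′<u)) (j-part u u<L)))
                     (sym (∑<-δ L (λ u′ → z (P ℕ.+ suc u′)) u<L)) ⟩
      Δψ z (src b) - Δψ z (tgt b) + - S₁ u + S₀ u
        ≡⟨ cong (λ w → w + - S₁ u + S₀ u) (cong₂ (λ x y → Δψ z x - Δψ z y) (proj₁ (j-arrow u u<L)) (proj₂ (j-arrow u u<L))) ⟩
      Δψ z (V u) - Δψ z (V (suc u)) + - S₁ u + S₀ u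
        ≡⟨ cong (λ w → w + - S₁ u + S₀ u) (cong₂ _-_ (cong₂ _-_ (ψ-1+V z (ℕ.<⇒≤ u<L)) (ψ-V z (ℕ.<⇒≤ u<L)))
                                                       (cong₂ _-_ (ψ-1+V z u<L) (ψ-V z u<L))) ⟩
      (S₁ u - S₀ u) - (S₀ u - S₀ (suc u)) + - S₁ u + S₀ u
        ≡⟨ telescope (S₁ u) (S₀ u) (S₀ (suc u)) ⟩
      S₀ (suc u) - S₀ u
        ≡⟨ cong₂ _-_ (ψ-V z u<L) (ψ-V z (ℕ.<⇒≤ u<L)) ⟨
      ψ z (V (suc u)) - ψ z (V u)
        ≡⟨ cong₂ (λ x y → ψ z y - ψ z x) (proj₁ (j-arrow u u<L)) (proj₂ (j-arrow u u<L)) ⟨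
      ψ z (tgt b) - ψ z (src b) ∎
      where
        open ≡-Reasoning
        b = P ℕ.+ suc u
        b<n : b < n
        b<n = s≤s (ℕ.≤-trans (ℕ.+-monoʳ-≤ P u<L) (ℕ.m≤m+n A (2 ℕ.* d)))
        g : ℕ → ℤ
        g a = z a * ⟪ a , b ⟫
        S₀ S₁ : ℕ → ℤ
        S₀ x = ∑< L (λ u′ → δ u′ x * z (P ℕ.+ suc u′))
        S₁ x = ∑< L (λ u′ → δ (suc u′) x * z (P ℕ.+ suc u′))
        earlier-j : ∀ {u′} → u′ < u → g (suc P ℕ.+ u′) ≡ z (P ℕ.+ suc u′) * - δ (suc u′) u
        earlier-j {u′} u′<u = trans (cong g (sym (ℕ.+-suc P u′))) (cong (z (P ℕ.+ suc u′) *_) (⟪⟫-j u′<u u<L))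
        j-part : ∀ u → u < L → ∑< u (λ u′ → z (P ℕ.+ suc u′) * - δ (suc u′) u) ≡ - S₁ u
        j-part zero    _     = cong -_ (sym (∑<-zero L (λ u′ _ → ℤ.*-zeroˡ (z (P ℕ.+ suc u′)))))
        j-part (suc u) 1+u<L = trans (∑<-*-δ-pred u (λ u′ → z (P ℕ.+ suc u′)))
          (cong -_ (sym (∑<-δ L (λ u′ → z (P ℕ.+ suc u′)) (ℕ.<-trans (ℕ.n<1+n u) 1+u<L))))
        telescope : ∀ p q r → (p - q) - (q - r) + - p + q ≡ r - q
        telescope = solve-∀

    row-bundle : ∀ {t} → t ≤ 2 ℕ.* d → row z (A ℕ.+ t) ≡ σ t * row z A
    row-bundle {t} t≤2d = begin
      row z (A ℕ.+ t)
        ≡⟨ row-split z (bundle<n t≤2d) ⟩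
      ∑< (A ℕ.+ t) g + z (A ℕ.+ t)
        ≡⟨ cong₂ _+_ (∑<-split A t g) (z-on-bundle t t≤2d) ⟩
      ∑< A g + ∑< t (λ t′ → g (A ℕ.+ t′)) + κ
        ≡⟨ cong₂ (λ x y → x + y + κ) before-bundle within-bundle ⟩
      σ t * X + κ * σ t * + 2 * ∑< t σ + κ
        ≡⟨ cong (λ S → σ t * X + κ * σ t * + 2 * S + κ) (∑<σ t) ⟩
      σ t * X + κ * σ t * + 2 * (if even t then 0ℤ else 1ℤ) + κ
        ≡⟨ parity (even t) X ⟩
      σ t * (X + κ)
        ≡⟨ cong (σ t *_) row-α ⟨
      σ t * row z A ∎
      where
        open ≡-Reasoning
        g : ℕ → ℤ
        g a = z a * ⟪ a , A ℕ.+ t ⟫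
        X = ∑< A (λ a → z a * ⟪ a , A ⟫)
        rearrange : ∀ x s y → x * (s * y) ≡ s * (x * y)
        rearrange = solve-∀
        before-bundle : ∑< A g ≡ σ t * X
        before-bundle = trans (∑<-cong A (λ a _ → trans (cong (z a *_) (⟪⟫-bundleʳ t≤2d a)) (rearrange (z a) (σ t) ⟪ a , A ⟫)))
          (sym (*-distribˡ-∑< A (σ t) (λ a → z a * ⟪ a , A ⟫)))
        within-bundle : ∑< t (λ t′ → g (A ℕ.+ t′)) ≡ κ * σ t * + 2 * ∑< t σ
        within-bundle = trans (∑<-cong t (λ t′ t′<t → let t′≤2d = ℕ.≤-trans (ℕ.<⇒≤ t′<t) t≤2d in begin
            z (A ℕ.+ t′) * ⟪ A ℕ.+ t′ , A ℕ.+ t ⟫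
              ≡⟨ cong₂ _*_ (z-on-bundle t′ t′≤2d) (⟪⟫-bundleˡ t′≤2d (A ℕ.+ t)) ⟩
            κ * (σ t′ * ⟪ A , A ℕ.+ t ⟫)
              ≡⟨ cong (λ w → κ * (σ t′ * w)) (trans (⟪⟫-bundleʳ t≤2d A) (cong (σ t *_) (⟪a,a⟫≡2 A A<n))) ⟩
            κ * (σ t′ * (σ t * + 2))
              ≡⟨ regroup κ (σ t′) (σ t) ⟩
            κ * σ t * + 2 * σ t′ ∎))
          (sym (*-distribˡ-∑< t (κ * σ t * + 2) σ))
          where
            regroup : ∀ k s s′ → k * (s * (s′ * + 2)) ≡ k * s′ * + 2 * s
            regroup = solve-∀
        row-α : row z A ≡ X + κ
        row-α = trans (row-split z A<n) (cong (λ w → X + w) (trans (cong z (sym (ℕ.+-identityʳ A))) (z-on-bundle 0 z≤n)))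
        parity : ∀ b X → (if b then 1ℤ else -1ℤ) * X + κ * (if b then 1ℤ else -1ℤ) * + 2 * (if b then 0ℤ else 1ℤ) + κ
                       ≡ (if b then 1ℤ else -1ℤ) * (X + κ)
        parity true  X = even-case X κ
          where
            even-case : ∀ X k → 1ℤ * X + k * 1ℤ * + 2 * 0ℤ + k ≡ 1ℤ * (X + k)
            even-case = solve-∀
        parity false X = odd-case X κ
          where
            odd-case : ∀ X k → -1ℤ * X + k * -1ℤ * + 2 * 1ℤ + k ≡ -1ℤ * (X + k)
            odd-case = solve-∀

    row-coboundary : ∀ {b} → b < n → row z b ≡ ψ z (tgt b) - ψ z (src b)
    row-coboundary b<n with kind b<n
    ... | path-kind b≤P     = row-path b≤P
    ... | j-kind u u<L refl = row-j u<L
    ... | k-kind t t<2d refl = begin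
      row z (A ℕ.+ suc t)                                     ≡⟨ row-bundle t<2d ⟩
      σ (suc t) * row z A                                     ≡⟨ cong (σ (suc t) *_) row-α ⟩
      σ (suc t) * (ψ z tα - ψ z sα)                           ≡⟨ flip (σ (suc t)) (ψ z sα) (ψ z tα) ⟩
      - (σ (suc t) * (ψ z sα - ψ z tα))                       ≡⟨ cong -_ (bundle-difference t<2d (ψ z)) ⟨
      - (ψ z (src (A ℕ.+ suc t)) - ψ z (tgt (A ℕ.+ suc t)))   ≡⟨ neg-sub (ψ z (src (A ℕ.+ suc t))) (ψ z (tgt (A ℕ.+ suc t))) ⟩
      ψ z (tgt (A ℕ.+ suc t)) - ψ z (src (A ℕ.+ suc t))       ∎
      where
        open ≡-Reasoning
        flip : ∀ s x y → s * (y - x) ≡ - (s * (x - y))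
        flip = solve-∀
        neg-sub : ∀ x y → - (x - y) ≡ y - x
        neg-sub = solve-∀
        row-α : row z A ≡ ψ z tα - ψ z sα
        row-α with kind A<n
        ... | path-kind A≤P      = trans (row-path A≤P) (cong₂ (λ x y → ψ z y - ψ z x) α-src α-tgt)
        ... | j-kind u u<L A≡j   = trans (cong (row z) A≡j) (trans (row-j u<L)
                                     (cong₂ (λ x y → ψ z y - ψ z x) (trans (cong src (sym A≡j)) α-src) (trans (cong tgt (sym A≡j)) α-tgt)))
        ... | k-kind _ _ A≡A+1+t = contradiction A≡A+1+t (ℕ.<⇒≢ (ℕ.m<m+n A (s≤s z≤n)))

    B-bundle-constant≡0 : ∀ s → Rad s → B z s ≡ 0ℤ
    B-bundle-constant≡0 s s∈Rad = begin
      B z s                                                 ≡⟨ B≡∑row z s ⟩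
      ∑< n (λ b → row z b * s b)                            ≡⟨ ∑<-cong n (λ b b<n → trans (cong (_* s b) (row-coboundary b<n))
                                                                 (flip (ψ z (src b)) (ψ z (tgt b)) (s b))) ⟩
      ∑< n (λ b → - (s b * (ψ z (src b) - ψ z (tgt b))))   ≡⟨ ∑<-neg n (λ b → s b * (ψ z (src b) - ψ z (tgt b))) ⟩
      - flux s (ψ z)                                        ≡⟨ cong -_ (Rad⇒flux≡0 path (s≤s z≤n) s s∈Rad (ψ z)) ⟩
      0ℤ                                                    ∎
      where
        open ≡-Reasoning
        flip : ∀ x y w → (y - x) * w ≡ - (w * (x - y))
        flip = solve-∀

  bundle-vector : (ℕ → ℤ) → ℕ → ℤ
  bundle-vector c b = ∑< (suc (2 ℕ.* d)) (λ t → δ (A ℕ.+ t) b * c t)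

  bundle-vector-on-bundle : ∀ c {t} → t ≤ 2 ℕ.* d → bundle-vector c (A ℕ.+ t) ≡ c t
  bundle-vector-on-bundle c {t} t≤2d = trans (∑<-cong (suc (2 ℕ.* d)) (λ t′ _ → cong (_* c t′) (δ-+ A t′ t)))
    (∑<-δ (suc (2 ℕ.* d)) c (s≤s t≤2d))

  bundle-vector∈Rad : ∀ c → ∑< (suc (2 ℕ.* d)) (λ t → σ t * c t) ≡ 0ℤ → Rad (bundle-vector c)
  bundle-vector∈Rad c ∑σc≡0 b _ = begin
    ∑< n (λ a → ⟪ b , a ⟫ * ∑< (suc (2 ℕ.* d)) (λ t → δ (A ℕ.+ t) a * c t))
      ≡⟨ ∑<-matrix-assoc n (suc (2 ℕ.* d)) (λ a → ⟪ b , a ⟫) (λ a t → δ (A ℕ.+ t) a) c ⟩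
    ∑< (suc (2 ℕ.* d)) (λ t → ∑< n (λ a → ⟪ b , a ⟫ * δ (A ℕ.+ t) a) * c t)
      ≡⟨ ∑<-cong (suc (2 ℕ.* d)) (λ t t<1+2d → cong (_* c t) (trans
           (∑<-*δ n (λ a → ⟪ b , a ⟫) (bundle<n (ℕ.s≤s⁻¹ t<1+2d))) (⟪⟫-bundleʳ (ℕ.s≤s⁻¹ t<1+2d) b))) ⟩
    ∑< (suc (2 ℕ.* d)) (λ t → σ t * ⟪ b , A ⟫ * c t)
      ≡⟨ ∑<-cong (suc (2 ℕ.* d)) (λ t _ → regroup (σ t) ⟪ b , A ⟫ (c t)) ⟩
    ∑< (suc (2 ℕ.* d)) (λ t → ⟪ b , A ⟫ * (σ t * c t))
      ≡⟨ *-distribˡ-∑< (suc (2 ℕ.* d)) ⟪ b , A ⟫ (λ t → σ t * c t) ⟨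
    ⟪ b , A ⟫ * ∑< (suc (2 ℕ.* d)) (λ t → σ t * c t)
      ≡⟨ cong (⟪ b , A ⟫ *_) ∑σc≡0 ⟩
    ⟪ b , A ⟫ * 0ℤ
      ≡⟨ ℤ.*-zeroʳ ⟪ b , A ⟫ ⟩
    0ℤ ∎
    where
      open ≡-Reasoning
      regroup : ∀ s p x → s * p * x ≡ p * (s * x)
      regroup = solve-∀

  divide-on-radical : ∀ (a : ℤ) r → Rad r → (∀ t → t < 2 ℕ.* d → a ∣ r (A ℕ.+ t) - r (suc (A ℕ.+ t))) →
    Σ (ℕ → ℤ) λ r′ → Rad r′ × (∀ s → Rad s → B s r ≡ a * B s r′)
  divide-on-radical a r r∈Rad a∣Δr = bundle-vector c , bundle-vector∈Rad c ∑σc≡0 , B-r≡a*B-r′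
    where
      open ≡-Reasoning
      quotients : Σ (ℕ → ℤ) λ k → ∀ t → t < 2 ℕ.* d → r (A ℕ.+ t) - r (suc (A ℕ.+ t)) ≡ k t * a
      quotients = bounded-choice {P = λ t k → r (A ℕ.+ t) - r (suc (A ℕ.+ t)) ≡ k * a} (2 ℕ.* d)
        (λ t t<2d → quotient (a∣Δr t t<2d) , _∣_.equality (a∣Δr t t<2d))
      k = proj₁ quotients
      g : ℕ → ℤ
      g zero    = 0ℤ
      g (suc t) = g t - k t
      r-on-bundle : ∀ t → t ≤ 2 ℕ.* d → r (A ℕ.+ t) ≡ r A + a * g t
      r-on-bundle zero    _ = trans (cong r (ℕ.+-identityʳ A))
        (sym (trans (cong (λ w → r A + w) (ℤ.*-zeroʳ a)) (ℤ.+-identityʳ (r A))))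
      r-on-bundle (suc t) t<2d = begin
        r (A ℕ.+ suc t)                     ≡⟨ cong r (ℕ.+-suc A t) ⟩
        r (suc (A ℕ.+ t))                   ≡⟨ solve-for-next (r (A ℕ.+ t)) (r (suc (A ℕ.+ t))) (k t * a) (proj₂ quotients t t<2d) ⟩
        r (A ℕ.+ t) - k t * a               ≡⟨ cong (_- k t * a) (r-on-bundle t (ℕ.<⇒≤ t<2d)) ⟩
        r A + a * g t - k t * a             ≡⟨ regroup (r A) a (g t) (k t) ⟩
        r A + a * (g t - k t)               ∎
        where
          solve-for-next : ∀ x y w → x - y ≡ w → y ≡ x - w
          solve-for-next x y w x-y≡w = trans (sym (cancel x y)) (cong (λ w → x - w) x-y≡w)
            where cancel : ∀ x y → x - (x - y) ≡ y
                  cancel = solve-∀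
          regroup : ∀ r₀ a g k → r₀ + a * g - k * a ≡ r₀ + a * (g - k)
          regroup = solve-∀
      S = ∑< (suc (2 ℕ.* d)) (λ t → σ t * g t)
      c : ℕ → ℤ
      c t = - S + g t
      ∑σc≡0 : ∑< (suc (2 ℕ.* d)) (λ t → σ t * c t) ≡ 0ℤ
      ∑σc≡0 = begin
        ∑< (suc (2 ℕ.* d)) (λ t → σ t * (- S + g t))
          ≡⟨ ∑<-cong (suc (2 ℕ.* d)) (λ t _ → ℤ.*-distribˡ-+ (σ t) (- S) (g t)) ⟩
        ∑< (suc (2 ℕ.* d)) (λ t → σ t * - S + σ t * g t)
          ≡⟨ ∑<-distrib-+ (suc (2 ℕ.* d)) (λ t → σ t * - S) (λ t → σ t * g t) ⟩
        ∑< (suc (2 ℕ.* d)) (λ t → σ t * - S) + S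
          ≡⟨ cong (_+ S) (*-distribʳ-∑< (suc (2 ℕ.* d)) (- S) σ) ⟨
        ∑< (suc (2 ℕ.* d)) σ * - S + S
          ≡⟨ cong (λ w → w * - S + S) (∑<σ-odd d) ⟩
        1ℤ * - S + S
          ≡⟨ cancel S ⟩
        0ℤ ∎
        where cancel : ∀ S → 1ℤ * - S + S ≡ 0ℤ
              cancel = solve-∀
      z : ℕ → ℤ
      z b = r b - a * bundle-vector c b
      z∈Rad : Rad z
      z∈Rad = Rad-combination {r} {bundle-vector c} a r∈Rad (bundle-vector∈Rad c ∑σc≡0)
      z-on-bundle : OnBundle z (r A - a * - S)
      z-on-bundle t t≤2d = begin
        r (A ℕ.+ t) - a * bundle-vector c (A ℕ.+ t)  ≡⟨ cong₂ (λ x y → x - a * y) (r-on-bundle t t≤2d) (bundle-vector-on-bundle c t≤2d) ⟩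
        r A + a * g t - a * (- S + g t)              ≡⟨ absorb (r A) a (g t) (- S) ⟩
        r A - a * - S                                ∎
        where absorb : ∀ r₀ a g l → r₀ + a * g - a * (l + g) ≡ r₀ - a * l
              absorb = solve-∀
      B-r≡a*B-r′ : ∀ s → Rad s → B s r ≡ a * B s (bundle-vector c)
      B-r≡a*B-r′ s s∈Rad = begin
        B s r                                         ≡⟨ B-congʳ s (λ b _ → split (r b) a (bundle-vector c b)) ⟩
        B s (λ b → a * bundle-vector c b + z b)       ≡⟨ form-linearʳ n Ǧℕ s a (bundle-vector c) z ⟩
        a * B s (bundle-vector c) + B s z             ≡⟨ cong (λ w → a * B s (bundle-vector c) + w) (B-antisym s z z∈Rad) ⟩
        a * B s (bundle-vector c) + - B z s           ≡⟨ cong (λ w → a * B s (bundle-vector c) + - w)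
                                                             (B-bundle-constant≡0 {z} {r A - a * - S} z∈Rad z-on-bundle s s∈Rad) ⟩
        a * B s (bundle-vector c) + - 0ℤ              ≡⟨ ℤ.+-identityʳ _ ⟩
        a * B s (bundle-vector c)                     ∎
        where split : ∀ x a y → x ≡ a * y + (x - a * y)
              split = solve-∀

  restrictionGram-pure : ∀ {c} (K : Mat n c) → IsRadBasis q K → IsPure (restrictionGram q K)
  restrictionGram-pure {c} K K-basis@(K·z∈rad , _ , K-spans) a x a≢0 (y , Wy≐ax) = y′ , Wy′≐x
    where
      open ≡-Reasoning
      r : ℕ → ℤ
      r = extend (K · y)
      B-column-r : ∀ i → B (column K i) r ≡ a * x i
      B-column-r i = trans (sym (restrictionGram·≡B K y i)) (Wy≐ax i)
      a∣Δr : ∀ t → t < 2 ℕ.* d → a ∣ r (A ℕ.+ t) - r (suc (A ℕ.+ t))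
      a∣Δr t t<2d = divides (∑ (λ i → w i * x i)) (begin
        r (A ℕ.+ t) - r (suc (A ℕ.+ t))    ≡⟨ B-2-cycle (1+A+t<n t<2d) (bundle-antiparallel t<2d) r ⟨
        B (2-cycle (A ℕ.+ t)) r            ≡⟨ B-congˡ r (λ b b<n → sym (trans (extend-cong K·w≐cycle b)
                                                                         (extend-∘toℕ (2-cycle (A ℕ.+ t)) b b<n))) ⟩
        B (extend (K · w)) r               ≡⟨ B-combination K w r ⟩
        ∑ (λ i → w i * B (column K i) r)   ≡⟨ ∑-cong (λ i → trans (cong (w i *_) (B-column-r i)) (rearrange (w i) a (x i))) ⟩
        ∑ (λ i → w i * x i * a)            ≡⟨ *-distribʳ-∑ (λ i → w i * x i) a ⟨
        ∑ (λ i → w i * x i) * a            ∎)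
        where
          cycle∈Rad = 2-cycle∈Rad (1+A+t<n t<2d) (bundle-antiparallel t<2d)
          spanned = K-spans (2-cycle (A ℕ.+ t) ∘ toℕ) (Rad⇒inRad (2-cycle (A ℕ.+ t)) cycle∈Rad)
          w = proj₁ spanned
          K·w≐cycle = proj₂ spanned
          rearrange : ∀ w a x → w * (a * x) ≡ w * x * a
          rearrange = solve-∀
      reduced = divide-on-radical a r (inRad⇒Rad (K · y) (K·z∈rad y)) a∣Δr
      r′ = proj₁ reduced
      spanned′ = K-spans (r′ ∘ toℕ) (Rad⇒inRad r′ (proj₁ (proj₂ reduced)))
      y′ = proj₁ spanned′
      Wy′≐x : (restrictionGram q K · y′) ≐ x
      Wy′≐x i = ℤ.*-cancelˡ-≡ a ((restrictionGram q K · y′) i) (x i) {{ℤ.≢-nonZero a≢0}} (begin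
        a * (restrictionGram q K · y′) i        ≡⟨ cong (a *_) (restrictionGram·≡B K y′ i) ⟩
        a * B (column K i) (extend (K · y′))    ≡⟨ cong (a *_) (B-congʳ (column K i) (λ b b<n →
                                                     trans (extend-cong (proj₂ spanned′) b) (extend-∘toℕ r′ b b<n))) ⟩
        a * B (column K i) r′                   ≡⟨ proj₂ (proj₂ reduced) (column K i) (column∈Rad K K-basis i) ⟨
        B (column K i) r                        ≡⟨ B-column-r i ⟩
        a * x i                                 ∎)


-- The standard quivers

sum-take-< : ∀ (π : List ℕ) → All (0 <_) π → ∀ {u} → u < length π → List.sum (take u π) < List.sum (take (suc u) π)
sum-take-< (x ∷ xs) (0<x ∷ _)   {zero}  _           = subst (0 <_) (sym (ℕ.+-identityʳ x)) 0<x
sum-take-< (x ∷ xs) (_ ∷ 0<xs) {suc u} (s≤s u<len) = ℕ.+-monoʳ-< x (sum-take-< xs 0<xs u<len)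

sum-take-≤ : ∀ (π : List ℕ) k → List.sum (take k π) ≤ List.sum π
sum-take-≤ []       zero    = z≤n
sum-take-≤ []       (suc k) = z≤n
sum-take-≤ (x ∷ xs) zero    = z≤n
sum-take-≤ (x ∷ xs) (suc k) = ℕ.+-monoʳ-≤ x (sum-take-≤ xs k)

sum-take-init : ∀ x xs → All (0 <_) (x ∷ xs) → List.sum (take (length xs) (x ∷ xs)) < List.sum (x ∷ xs)
sum-take-init x []       (0<x ∷ _)   = subst (0 <_) (sym (ℕ.+-identityʳ x)) 0<x
sum-take-init x (y ∷ ys) (_ ∷ 0<y∷ys) = ℕ.+-monoʳ-< x (sum-take-init y ys 0<y∷ys)

module StandardQuiver (P x : ℕ) (xs : List ℕ) (d : ℕ)
  (positive : All (0 <_) (x ∷ xs)) (sum≡m : List.sum (x ∷ xs) ≡ suc (suc P)) where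

  m L : ℕ
  m = suc (suc P)
  L = length xs

  π : List ℕ
  π = x ∷ xs

  V : ℕ → ℕ
  V = vpt m π

  src tgt : ℕ → ℕ
  src a = stdSrc m π (suc a)
  tgt a = stdTgt m π (suc a)

  V-step : ∀ u → u < L → V (suc u) < V u
  V-step u u<L = ℕ.∸-monoʳ-< (sum-take-< π positive (s≤s (ℕ.<⇒≤ u<L)))
    (subst (List.sum (take (suc u) π) ≤_) sum≡m (sum-take-≤ π (suc u)))

  1≤V : 1 ≤ V L
  1≤V = ℕ.m<n⇒0<n∸m (subst (List.sum (take L π) <_) sum≡m (sum-take-init x xs positive))

  path-arrow : ∀ a → a ≤ P → src a ≡ suc a × tgt a ≡ suc (suc a)
  path-arrow a a≤P rewrite <ᵇ-< {suc a} {m} (s≤s (s≤s a≤P)) = refl , refl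

  1+j≮m : ∀ u → ¬ suc (P ℕ.+ suc u) < m
  1+j≮m u = ℕ.≤⇒≯ (s≤s (subst (suc P ≤_) (sym (ℕ.+-suc P u)) (s≤s (ℕ.m≤m+n P u))))

  1+j<m+L : ∀ {u} → u < L → suc (P ℕ.+ suc u) < m ℕ.+ L
  1+j<m+L u<L = s≤s (s≤s (ℕ.+-monoʳ-≤ P u<L))

  j-arrow : ∀ u → u < L → src (P ℕ.+ suc u) ≡ V u × tgt (P ℕ.+ suc u) ≡ V (suc u)
  j-arrow u u<L rewrite <ᵇ-≮ (1+j≮m u) | <ᵇ-< (1+j<m+L u<L) = cong V r∸m≡u , cong (V ∘ suc) r∸m≡u
    where
      r∸m≡u : suc (P ℕ.+ suc u) ℕ.∸ m ≡ u
      r∸m≡u = trans (cong (ℕ._∸ suc P) (ℕ.+-suc P u)) (ℕ.m+n∸m≡n (suc P) u)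

  1+k≮m+L : ∀ t → ¬ suc (P ℕ.+ L ℕ.+ suc t) < m ℕ.+ L
  1+k≮m+L t = ℕ.≤⇒≯ (s≤s (subst (suc (P ℕ.+ L) ≤_) (sym (ℕ.+-suc (P ℕ.+ L) t)) (s≤s (ℕ.m≤m+n (P ℕ.+ L) t))))

  1+k≮m : ∀ t → ¬ suc (P ℕ.+ L ℕ.+ suc t) < m
  1+k≮m t = 1+k≮m+L t ∘ λ r<m → ℕ.<-≤-trans r<m (ℕ.m≤m+n m L)

  k-arrow : ∀ t → t ≤ 2 ℕ.* d →
    src (P ℕ.+ L ℕ.+ t) ≡ (if even t then sα m π else tα m π) ×
    tgt (P ℕ.+ L ℕ.+ t) ≡ (if even t then tα m π else sα m π)
  k-arrow zero _ = α-arrow xs refl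
    where
      α-arrow : ∀ ys → ys ≡ xs → src (P ℕ.+ L ℕ.+ 0) ≡ sα m π × tgt (P ℕ.+ L ℕ.+ 0) ≡ tα m π
      α-arrow []       refl = let P+0+0≡P = trans (ℕ.+-identityʳ _) (ℕ.+-identityʳ P) in
        trans (cong src P+0+0≡P) (proj₁ (path-arrow P ℕ.≤-refl)) ,
        trans (cong tgt P+0+0≡P) (proj₂ (path-arrow P ℕ.≤-refl))
      α-arrow (y ∷ ys) refl = let P+L+0≡P+L = ℕ.+-identityʳ (P ℕ.+ L) in
        trans (cong src P+L+0≡P+L) (proj₁ (j-arrow (length ys) ℕ.≤-refl)) ,
        trans (cong tgt P+L+0≡P+L) (proj₂ (j-arrow (length ys) ℕ.≤-refl))
  k-arrow (suc t) _ rewrite <ᵇ-≮ (1+k≮m t) | <ᵇ-≮ (1+k≮m+L t) =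
    cong (λ k → if even k then sα m π else tα m π) index≡ , cong (λ k → if even k then tα m π else sα m π) index≡
    where
      index≡ : suc (P ℕ.+ L ℕ.+ suc t) ℕ.∸ (m ℕ.+ L) ℕ.+ 1 ≡ suc t
      index≡ = trans (cong (λ r → r ℕ.∸ (m ℕ.+ L) ℕ.+ 1) (cong suc (ℕ.+-suc (P ℕ.+ L) t)))
                     (trans (cong (ℕ._+ 1) (ℕ.m+n∸m≡n (P ℕ.+ L) t)) (ℕ.+-comm t 1))

lemma2p8 : (m : ℕ) → m ≥ 2 → (π : List ℕ) → IsPartition m π → (d : ℕ) →
    let n = nArrows m π d
        q = qQ (stdQuiver m π d)
    in (c : ℕ) (K : Mat n c) → IsRadBasis q K → IsPure (restrictionGram q K)
lemma2p8 (suc zero) (s≤s ()) _ _ _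
lemma2p8 (suc (suc P)) _ [] (_ , _ , ()) _
lemma2p8 (suc (suc P)) _ (x ∷ xs) (positive , _ , sum≡m) d _ =
  StandardShape.restrictionGram-pure P (length xs) d V (sα m π) (tα m π) src tgt path-arrow j-arrow k-arrow refl V-step 1≤V
  where open StandardQuiver P x xs d positive sum≡m
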